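{- Let $n\ge 3$ and consider triangulations of a convex $n$-gon whose vertices are labeled $1,2,\ldots,n$ in cyclic order around the polygon. Each triangulation is regarded as a graph on these $n$ vertices, whose edges are the sides of the polygon together with the diagonals of the triangulation. The clip sequence of a triangulation is a permutation of $\{1,2,\ldots,n-2\}$. The set of clip sequences of triangulations of the $n$-gon is exactly the set $S_{n-2}(312)$ of $312$-avoiding permutations of $\{1,2,\ldots,n-2\}$. Moreover, the map sending each triangulation of the $n$-gon to its clip sequence is a bijection from the set of triangulations of the $n$-gon onto $S_{n-2}(312)$.
   Context: The clip sequence of a triangulation is the output of the following procedure. At each step, delete the vertex of degree $2$ that has the smallest label, together with its two incident edges, and record the label of the deleted vertex. The procedure is repeated $n-2$ times, and the sequence of recorded labels is the clip sequence. A permutation $a_1a_2\ldots a_m$ is $312$-avoiding if there are no indices $i<j<k$ with $a_j<a_k<a_i$. -}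

module Defs where

open import Data.Nat using (ℕ; zero; suc; _+_; _∸_; _≤_; _<_; _≡ᵇ_)
open import Data.Bool using (Bool; true; false; _∧_; _∨_; if_then_else_)
open import Data.List using (List; []; _∷_; map; length; upTo; lookup)
open import Data.List.Membership.Propositional using (_∈_; _∉_)
open import Data.List.Relation.Unary.All using (All)
open import Data.Maybe using (Maybe; just; nothing)
open import Data.Product using (_×_; _,_; ∃; ∃-syntax)
open import Data.Sum using (_⊎_)
open import Data.Fin using (Fin)
import Data.Fin as F
open import Relation.Binary.PropositionalEquality using (_≡_)
open import Relation.Nullary using (¬_)

-- Vertices of the n-gon are the labels 1,2,…,n in cyclic order.
Edge : Set
Edge = ℕ × ℕ

range : ℕ → ℕ → List ℕ
range a zero = []
range a (suc k) = a ∷ range (suc a) k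

labels : ℕ → List ℕ
labels n = range 1 n

-- A diagonal (i , j) is stored with i < j; it joins two non-adjacent vertices.
IsDiagonal : ℕ → Edge → Set
IsDiagonal n (i , j) = 1 ≤ i × (i + 2 ≤ j) × j ≤ n × ¬ (i ≡ 1 × j ≡ n)

-- two diagonals cross (in their interiors) iff their endpoints interleave
Crosses : Edge → Edge → Set
Crosses (a , b) (c , d) = (a < c × c < b × b < d) ⊎ (c < a × a < d × d < b)

-- A triangulation = maximal set of pairwise non-crossing diagonals
-- (given by a list D; only its underlying set matters).
IsTriangulation : ℕ → List Edge → Set
IsTriangulation n D =
  All (IsDiagonal n) D
  × (∀ d e → d ∈ D → e ∈ D → ¬ Crosses d e)
  × (∀ d → IsDiagonal n d → d ∉ D → ∃[ e ] (e ∈ D × Crosses d e))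

sides : ℕ → List Edge
sides n = (1 , n) ∷ map (λ i → (i , suc i)) (range 1 (n ∸ 1))

graphEdges : ℕ → List Edge → List Edge
graphEdges n D = sides n Data.List.++ D

adjacent : List Edge → ℕ → ℕ → Bool
adjacent [] u v = false
adjacent ((a , b) ∷ E) u v =
  (((a ≡ᵇ u) ∧ (b ≡ᵇ v)) ∨ ((a ≡ᵇ v) ∧ (b ≡ᵇ u))) ∨ adjacent E u v

-- degree of v in the subgraph induced on the (not yet deleted) vertices
degree : List Edge → List ℕ → ℕ → ℕ
degree E [] v = zero
degree E (u ∷ alive) v =
  if adjacent E u v then suc (degree E alive v) else degree E alive v

-- smallest remaining vertex of degree 2 (alive list is kept increasing)
firstDeg2 : List Edge → List ℕ → List ℕ → Maybe ℕ
firstDeg2 E alive [] = nothing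
firstDeg2 E alive (v ∷ vs) =
  if degree E alive v ≡ᵇ 2 then just v else firstDeg2 E alive vs

delete : ℕ → List ℕ → List ℕ
delete v [] = []
delete v (u ∷ us) = if u ≡ᵇ v then delete v us else u ∷ delete v us

clipSteps : ℕ → List Edge → List ℕ → Maybe (List ℕ)
clipSteps zero E alive = just []
clipSteps (suc k) E alive with firstDeg2 E alive alive
... | nothing = nothing
... | just v with clipSteps k E (delete v alive)
...   | nothing = nothing
...   | just s = just (v ∷ s)

clipSeq : ℕ → List Edge → Maybe (List ℕ)
clipSeq n D = clipSteps (n ∸ 2) (graphEdges n D) (labels n)

Avoids312 : List ℕ → Set
Avoids312 σ = ∀ (i j k : Fin (length σ)) → i F.< j → j F.< k →
  ¬ (lookup σ j < lookup σ k × lookup σ k < lookup σ i)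

-- Cutting the n-gon along the triangle on its side (n - 1 , n) leaves two smaller triangulated
-- polygons, so a triangulation is a binary tree whose inorder traversal is 1, …, n - 2 (tree vertex 0
-- stands for n). Clipping works through the tree in postorder: inside the subpolygon on a base
-- (p , q) with apex k, the vertices of the left part have the smallest labels and are clipped first,
-- then those of the right part, and then k, whose only remaining neighbours are p and q; meanwhile
-- every alive vertex below p keeps a third neighbour. Finally, postorders of binary trees with a
-- fixed inorder are exactly the 312-avoiding permutations: the last entry k is the root, and the
-- entries below k precede those above k. A tree is recovered from its postorder in the same way.

module Submission where

open import Defs
open import Data.Nat using (ℕ; zero; suc; _+_; _∸_; _≤_; _<_; _≤′_; ≤′-refl; ≤′-step; _≡ᵇ_; z≤n; s≤s; _≟_; _≤?_; _<?_)
open import Data.Nat.Properties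
open import Data.Nat.Induction using (<-rec)
open import Data.Bool using (T; true; false; _∧_)
open import Data.Bool.Properties using (T-∨; T-∧)
open import Data.Fin using (Fin) renaming (zero to fzero; suc to fsuc)
import Data.Fin as F
open import Data.List using (List; []; _∷_; _++_; _∷ʳ_; map; length; lookup; filter; filterᵇ; initLast; _∷ʳ′_)
open import Data.List.Properties
  using (++-assoc; ++-identityʳ; ∷ʳ-injective; filter-++; filter-all; filter-none; filter-accept; filter-reject; filter-notAll)
open import Data.List.Membership.Propositional using (_∈_; _∉_)
open import Data.List.Membership.Propositional.Properties
  using (∈-++⁺ˡ; ∈-++⁺ʳ; ∈-++⁻; ∈-map⁺; ∈-map⁻; ∈-filter⁺; ∈-filter⁻; ∈-lookup)
import Data.List.Membership.DecPropositional as DecMembership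
open import Data.List.Relation.Unary.Any as Any using (here; there)
open import Data.List.Relation.Unary.Any.Properties using (lookup-index)
open import Data.List.Relation.Unary.All as All using (All; []; _∷_)
import Data.List.Relation.Unary.All.Properties as All
open import Data.List.Relation.Unary.AllPairs as AllPairs using (AllPairs; []; _∷_)
import Data.List.Relation.Unary.AllPairs.Properties as AllPairs
open import Data.List.Relation.Unary.Unique.Propositional using (Unique)
import Data.List.Relation.Unary.Unique.Propositional.Properties as Unique
open import Data.List.Relation.Binary.Subset.Propositional using (_⊆_)
open import Data.List.Relation.Binary.Subset.Propositional.Properties using (⊆-refl; ⊆-trans; xs⊆x∷xs; xs⊆ys++xs; ++⁺ʳ; ∷⁺ʳ)
open import Data.List.Relation.Binary.Permutation.Propositional using (_↭_; ↭-refl; ↭-sym; ↭-trans; ↭-reflexive; prep)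
open import Data.List.Relation.Binary.Permutation.Propositional.Properties
  using (∈-resp-↭; ++⁺; ∷↭∷ʳ; drop-mid; ↭-empty-inv; filter-↭)
open import Data.Maybe using (Maybe; just; nothing)
import Data.Maybe as Maybe
import Data.Maybe.Properties as Maybe
open import Data.Product using (Σ; ∃; ∃-syntax; _×_; _,_; proj₁; proj₂)
open import Data.Product.Properties using (≡-dec; ×-≡,≡←≡)
open import Data.Sum using (_⊎_; inj₁; inj₂; [_,_]′)
import Data.Sum
open import Data.Unit using (⊤; tt)
open import Function using (_∘′_; case_of_)
open import Function.Bundles using (_⇔_; mk⇔; Equivalence)
open import Function.Construct.Composition using (_⇔-∘_)
open import Function.Construct.Identity using (⇔-id)
open import Function.Construct.Symmetry using (⇔-sym)
open import Level using (0ℓ)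
open import Relation.Binary.Core using (Rel)
open import Relation.Binary.Definitions using (DecidableEquality; tri<; tri≈; tri>)
open import Relation.Binary.PropositionalEquality
open import Relation.Nullary using (¬_; ¬?; Dec; yes; no; contradiction)
open import Relation.Nullary.Decidable using (T?; _⊎-dec_)
open import Relation.Unary using (Decidable)

∈-range⁺ : ∀ {i} a l → a ≤ i → i < a + l → i ∈ range a l
∈-range⁺ {i} a zero a≤i i<a+0 = contradiction a≤i (<⇒≱ (subst (i <_) (+-identityʳ a) i<a+0))
∈-range⁺ {i} a (suc l) a≤i i<a+1+l with i ≟ a
... | yes refl = here refl
... | no i≢a = there (∈-range⁺ (suc a) l (≤∧≢⇒< a≤i (i≢a ∘′ sym)) (subst (i <_) (+-suc a l) i<a+1+l))

∈-range⁻ : ∀ {i} a l → i ∈ range a l → a ≤ i × i < a + l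
∈-range⁻ a (suc l) (here refl) = ≤-refl , subst (a <_) (sym (+-suc a l)) (s≤s (m≤m+n a l))
∈-range⁻ {i} a (suc l) (there i∈) =
  let (a<i , i<) = ∈-range⁻ (suc a) l i∈ in <⇒≤ a<i , subst (i <_) (sym (+-suc a l)) i<

range-++ : ∀ a l₁ l₂ → range a (l₁ + l₂) ≡ range a l₁ ++ range (a + l₁) l₂
range-++ a zero l₂ = cong (λ c → range c l₂) (sym (+-identityʳ a))
range-++ a (suc l₁) l₂ =
  cong (a ∷_) (trans (range-++ (suc a) l₁ l₂) (cong (λ c → range (suc a) l₁ ++ range c l₂) (sym (+-suc a l₁))))

∈-range-split : ∀ {k} c l → k ∈ range c l →
                ∃[ i ] ∃[ j ] (l ≡ i + suc j × k ≡ c + i × range c l ≡ range c i ++ k ∷ range (suc k) j)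
∈-range-split c (suc l) (here refl) = 0 , l , refl , sym (+-identityʳ c) , refl
∈-range-split c (suc l) (there k∈) =
  let (i , j , l≡ , k≡ , range≡) = ∈-range-split (suc c) l k∈ in
  suc i , j , cong suc l≡ , trans k≡ (sym (+-suc c i)) , cong (c ∷_) range≡

∷ʳ≢[] : ∀ {A : Set} (xs : List A) {x} → xs ∷ʳ x ≢ []
∷ʳ≢[] [] ()
∷ʳ≢[] (_ ∷ _) ()

Sorted : List ℕ → Set
Sorted = AllPairs _<_

sorted-middle : ∀ {pre k post} → Sorted pre → Sorted post → All (_< k) pre → All (k <_) post →
                Sorted (pre ++ k ∷ post)
sorted-middle pre-sorted post-sorted pre<k k<post =
  AllPairs.++⁺ pre-sorted (k<post ∷ post-sorted) (All.map (λ x<k → x<k ∷ All.map (<-trans x<k) k<post) pre<k)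

greatest-satisfying : ∀ {P : ℕ → Set} → (∀ n → Dec (P n)) → ∀ {lo hi} → lo ≤′ hi → P lo →
                      ∃[ k ] (lo ≤ k × k ≤ hi × P k × ∀ {j} → k < j → j ≤ hi → ¬ P j)
greatest-satisfying P? ≤′-refl p = _ , ≤-refl , ≤-refl , p , λ k<j j≤k → contradiction j≤k (<⇒≱ k<j)
greatest-satisfying {P} P? (≤′-step {hi} lo≤hi) p with P? (suc hi)
... | yes p′ = suc hi , ≤′⇒≤ (≤′-step lo≤hi) , ≤-refl , p′ , λ k<j j≤k → contradiction j≤k (<⇒≱ k<j)
... | no ¬p′ =
  let (k , lo≤k , k≤hi , pk , above) = greatest-satisfying P? lo≤hi p in
  k , lo≤k , m≤n⇒m≤1+n k≤hi , pk , extend above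
  where
  extend : ∀ {k} → (∀ {j} → k < j → j ≤ hi → ¬ P j) → ∀ {j} → k < j → j ≤ suc hi → ¬ P j
  extend above {j} k<j j≤1+hi with j ≟ suc hi
  ... | yes refl = ¬p′
  ... | no j≢1+hi = above k<j (≤-pred (≤∧≢⇒< j≤1+hi j≢1+hi))

⊆-insert : ∀ {A : Set} (xs ys zs : List A) → xs ++ zs ⊆ xs ++ ys ++ zs
⊆-insert xs ys zs = ++⁺ʳ xs (xs⊆ys++xs zs ys)

module _ {A : Set} (_≟ᴬ_ : DecidableEquality A) where

  unique-⊆⇒length≤ : ∀ {xs ys : List A} → Unique xs → xs ⊆ ys → length xs ≤ length ys
  unique-⊆⇒length≤ [] _ = z≤n
  unique-⊆⇒length≤ {x ∷ xs} {ys} (x∉xs ∷ uniq) x∷xs⊆ys =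
    ≤-trans (s≤s (unique-⊆⇒length≤ uniq xs⊆ys-x))
      (filter-notAll (λ y → ¬? (y ≟ᴬ x)) ys (Any.map (λ y≡x y≢x → y≢x (sym y≡x)) (x∷xs⊆ys (here refl))))
    where
    xs⊆ys-x : xs ⊆ filter (λ y → ¬? (y ≟ᴬ x)) ys
    xs⊆ys-x y∈ = ∈-filter⁺ (λ y → ¬? (y ≟ᴬ x)) (x∷xs⊆ys (there y∈)) (λ y≡x → All.lookup x∉xs y∈ (sym y≡x))

module _ {A : Set} {R : Rel A 0ℓ} where

  allPairs-lookup⁻ : ∀ {xs} → AllPairs R xs → ∀ {i j : Fin (length xs)} → i F.< j → R (lookup xs i) (lookup xs j)
  allPairs-lookup⁻ (Rx ∷ _) {fzero} {fsuc j} _ = All.lookup Rx (∈-lookup j)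
  allPairs-lookup⁻ (_ ∷ pairs) {fsuc i} {fsuc j} (s≤s i<j) = allPairs-lookup⁻ pairs i<j

  allPairs-lookup⁺ : ∀ {xs} → (∀ {i j : Fin (length xs)} → i F.< j → R (lookup xs i) (lookup xs j)) → AllPairs R xs
  allPairs-lookup⁺ {[]} _ = []
  allPairs-lookup⁺ {x ∷ xs} R-lookup =
    All.tabulate (λ z∈ → subst (R x) (sym (lookup-index z∈)) (R-lookup {fzero} {fsuc (Any.index z∈)} (s≤s z≤n))) ∷
    allPairs-lookup⁺ (λ i<j → R-lookup (s≤s i<j))

  allPairs-++⁻ˡ : ∀ xs {ys} → AllPairs R (xs ++ ys) → AllPairs R xs
  allPairs-++⁻ˡ [] _ = []
  allPairs-++⁻ˡ (x ∷ xs) (Rx ∷ pairs) = All.++⁻ˡ xs Rx ∷ allPairs-++⁻ˡ xs pairs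

  allPairs-right : ∀ {P : A → Set} {ys} → (∀ {y z} → P z → R y z) → All P ys → AllPairs R ys
  allPairs-right R-P [] = []
  allPairs-right R-P (_ ∷ Pys) = All.map R-P Pys ∷ allPairs-right R-P Pys

  allPairs-∷ʳ⁻ : ∀ xs {k} → AllPairs R (xs ++ k ∷ []) → All (λ y → R y k) xs
  allPairs-∷ʳ⁻ [] _ = []
  allPairs-∷ʳ⁻ (x ∷ xs) (Rx ∷ pairs) = All.lookup Rx (∈-++⁺ʳ xs (here refl)) ∷ allPairs-∷ʳ⁻ xs pairs

filter-separated : ∀ {k} xs {ys} → All (_< k) xs → All (k <_) ys →
                   filter (_<? k) (xs ++ ys) ≡ xs × filter (k <?_) (xs ++ ys) ≡ ys
filter-separated {k} xs {ys} xs<k k<ys =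
  trans (filter-++ (_<? k) xs ys)
    (trans (cong₂ _++_ (filter-all (_<? k) xs<k) (filter-none (_<? k) (All.map <-asym k<ys))) (++-identityʳ xs)) ,
  trans (filter-++ (k <?_) xs ys) (cong₂ _++_ (filter-none (k <?_) (All.map <-asym xs<k)) (filter-all (k <?_) k<ys))

degree≡length-filter : ∀ E alive v → degree E alive v ≡ length (filterᵇ (λ u → adjacent E u v) alive)
degree≡length-filter E [] v = refl
degree≡length-filter E (u ∷ alive) v with adjacent E u v
... | true = cong suc (degree≡length-filter E alive v)
... | false = degree≡length-filter E alive v

module _ (E : List Edge) where

  degree-≥ : ∀ {W alive v} → Unique W → W ⊆ alive → All (λ w → T (adjacent E w v)) W →
             length W ≤ degree E alive v
  degree-≥ {W} {alive} {v} uniq W⊆ adj = subst (length W ≤_) (sym (degree≡length-filter E alive v))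
    (unique-⊆⇒length≤ _≟_ uniq (λ w∈ → ∈-filter⁺ (λ u → T? (adjacent E u v)) (W⊆ w∈) (All.lookup adj w∈)))

  degree-≤ : ∀ {W alive v} → Unique alive → (∀ {u} → u ∈ alive → T (adjacent E u v) → u ∈ W) →
             degree E alive v ≤ length W
  degree-≤ {W} {alive} {v} uniq onlyW = subst (_≤ length W) (sym (degree≡length-filter E alive v))
    (unique-⊆⇒length≤ _≟_ (Unique.filter⁺ (λ u → T? (adjacent E u v)) uniq)
      (λ u∈ → let (u∈alive , adj) = ∈-filter⁻ (λ u → T? (adjacent E u v)) u∈ in onlyW u∈alive adj))

adjacent⁻ : ∀ E {u v} → T (adjacent E u v) → (u , v) ∈ E ⊎ (v , u) ∈ E
adjacent⁻ ((a , b) ∷ E) {u} {v} adj with Equivalence.to T-∨ adj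
... | inj₂ adjE = Data.Sum.map there there (adjacent⁻ E adjE)
... | inj₁ adjHere with Equivalence.to T-∨ adjHere
...   | inj₁ ab≡uv = let (a≡u , b≡v) = Equivalence.to T-∧ ab≡uv in
                     inj₁ (here (cong₂ _,_ (sym (≡ᵇ⇒≡ a u a≡u)) (sym (≡ᵇ⇒≡ b v b≡v))))
...   | inj₂ ab≡vu = let (a≡v , b≡u) = Equivalence.to T-∧ ab≡vu in
                     inj₂ (here (cong₂ _,_ (sym (≡ᵇ⇒≡ a v a≡v)) (sym (≡ᵇ⇒≡ b u b≡u))))

adjacent⁺ : ∀ E {u v} → (u , v) ∈ E ⊎ (v , u) ∈ E → T (adjacent E u v)
adjacent⁺ ((a , b) ∷ E) {u} {v} (inj₁ (here refl)) =
  Equivalence.from T-∨ (inj₁ (Equivalence.from T-∨ (inj₁ (Equivalence.from T-∧ (≡⇒≡ᵇ u u refl , ≡⇒≡ᵇ v v refl)))))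
adjacent⁺ ((a , b) ∷ E) {u} {v} (inj₂ (here refl)) =
  Equivalence.from T-∨ (inj₁ (Equivalence.from (T-∨ {(v ≡ᵇ u) ∧ (u ≡ᵇ v)})
    (inj₂ (Equivalence.from T-∧ (≡⇒≡ᵇ v v refl , ≡⇒≡ᵇ u u refl)))))
adjacent⁺ ((a , b) ∷ E) (inj₁ (there uv∈)) = Equivalence.from T-∨ (inj₂ (adjacent⁺ E (inj₁ uv∈)))
adjacent⁺ ((a , b) ∷ E) (inj₂ (there vu∈)) = Equivalence.from T-∨ (inj₂ (adjacent⁺ E (inj₂ vu∈)))

delete-absent : ∀ {v} xs → All (_≢ v) xs → delete v xs ≡ xs
delete-absent [] [] = refl
delete-absent {v} (u ∷ xs) (u≢v ∷ xs≢v) with u ≡ᵇ v in eq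
... | true = contradiction (≡ᵇ⇒≡ u v (subst T (sym eq) tt)) u≢v
... | false = cong (u ∷_) (delete-absent xs xs≢v)

delete-middle : ∀ {v} pre post → All (_≢ v) pre → All (_≢ v) post → delete v (pre ++ v ∷ post) ≡ pre ++ post
delete-middle {v} [] post _ post≢v with v ≡ᵇ v in eq
... | true = delete-absent post post≢v
... | false = contradiction (subst T eq (≡⇒≡ᵇ v v refl)) (λ ())
delete-middle {v} (u ∷ pre) post (u≢v ∷ pre≢v) post≢v with u ≡ᵇ v in eq
... | true = contradiction (≡ᵇ⇒≡ u v (subst T (sym eq) tt)) u≢v
... | false = cong (u ∷_) (delete-middle pre post pre≢v post≢v)

firstDeg2-middle : ∀ E alive pre {k} post → All (λ p → degree E alive p ≢ 2) pre → degree E alive k ≡ 2 →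
                   firstDeg2 E alive (pre ++ k ∷ post) ≡ just k
firstDeg2-middle E alive [] post _ deg≡2 rewrite deg≡2 = refl
firstDeg2-middle E alive (p ∷ pre) post (deg≢2 ∷ pre≢2) deg≡2 with degree E alive p ≡ᵇ 2 in eq
... | true = contradiction (≡ᵇ⇒≡ _ 2 (subst T (sym eq) tt)) deg≢2
... | false = firstDeg2-middle E alive pre post pre≢2 deg≡2

clipSteps-middle : ∀ E pre {k} post j → let alive = pre ++ k ∷ post in
                   All (λ p → degree E alive p ≢ 2) pre → degree E alive k ≡ 2 → All (_≢ k) pre → All (_≢ k) post →
                   clipSteps (suc j) E alive ≡ Maybe.map (k ∷_) (clipSteps j E (pre ++ post))
clipSteps-middle E pre {k} post j pre≢2 deg≡2 pre≢k post≢k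
  rewrite firstDeg2-middle E (pre ++ k ∷ post) pre post pre≢2 deg≡2 | delete-middle pre post pre≢k post≢k
  with clipSteps j E (pre ++ post)
... | nothing = refl
... | just s = refl

-- Crossings and dissection trees

crosses-sym : ∀ {x y} → Crosses x y → Crosses y x
crosses-sym (inj₁ c) = inj₂ c
crosses-sym (inj₂ c) = inj₁ c

nested⇒¬crosses : ∀ {c d p q} → c ≤ p → q ≤ d → ¬ Crosses (c , d) (p , q)
nested⇒¬crosses c≤p q≤d (inj₁ (_ , _ , d<q)) = <⇒≱ d<q q≤d
nested⇒¬crosses c≤p q≤d (inj₂ (p<c , _)) = <⇒≱ p<c c≤p

separated⇒¬crosses : ∀ {p q r s} → q ≤ r → ¬ Crosses (p , q) (r , s)
separated⇒¬crosses q≤r (inj₁ (_ , r<q , _)) = <⇒≱ r<q q≤r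
separated⇒¬crosses q≤r (inj₂ (r<p , p<s , s<q)) = <⇒≱ (<-trans r<p (<-trans p<s s<q)) q≤r

-- Tree a b : a triangulation of the polygon a, a + 1, …, b; node L R has the root triangle (a , k , b).
data Tree : ℕ → ℕ → Set where
  leaf : ∀ {a} → Tree a (suc a)
  node : ∀ {a k b} → Tree a k → Tree k b → Tree a b

tree-< : ∀ {a b} → Tree a b → a < b
tree-< leaf = ≤-refl
tree-< (node L R) = <-trans (tree-< L) (tree-< R)

chords : ∀ {a b} → Tree a b → List Edge
chords leaf = []
chords (node {a} {_} {b} L R) = (a , b) ∷ chords L ++ chords R

diagonals : ∀ {a b} → Tree a b → List Edge
diagonals leaf = []
diagonals (node L R) = chords L ++ chords R

diagonals⊆chords : ∀ {a b} (t : Tree a b) {x} → x ∈ diagonals t → x ∈ chords t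
diagonals⊆chords (node L R) = there

chord-rootOrDiagonal : ∀ {a b} (t : Tree a b) {x} → x ∈ chords t → x ≡ (a , b) ⊎ x ∈ diagonals t
chord-rootOrDiagonal (node L R) (here refl) = inj₁ refl
chord-rootOrDiagonal (node L R) (there x∈) = inj₂ x∈

∈-diagonals⁻ : ∀ {a k b} (L : Tree a k) (R : Tree k b) {x} →
               x ∈ diagonals (node L R) → x ∈ chords L ⊎ x ∈ chords R
∈-diagonals⁻ L R = ∈-++⁻ (chords L)

∈-diagonals⁺ˡ : ∀ {a k b} (L : Tree a k) (R : Tree k b) {x} → x ∈ chords L → x ∈ diagonals (node L R)
∈-diagonals⁺ˡ L R = ∈-++⁺ˡ

∈-diagonals⁺ʳ : ∀ {a k b} (L : Tree a k) (R : Tree k b) {x} → x ∈ chords R → x ∈ diagonals (node L R)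
∈-diagonals⁺ʳ L R = ∈-++⁺ʳ (chords L)

root∈chords : ∀ {a b} (t : Tree a b) → suc a < b → (a , b) ∈ chords t
root∈chords leaf 1+a<1+a = contradiction 1+a<1+a (<-irrefl refl)
root∈chords (node L R) _ = here refl

chords-all : ∀ {P : Edge → Set} {a b} (t : Tree a b) → (suc a < b → P (a , b)) →
             All P (diagonals t) → All P (chords t)
chords-all leaf _ _ = []
chords-all (node L R) P-root P-diagonals = P-root (≤-<-trans (tree-< L) (tree-< R)) ∷ P-diagonals

Within : ℕ → ℕ → Edge → Set
Within a b (p , q) = a ≤ p × q ≤ b

IsDiagonalOf : ℕ → ℕ → Edge → Set
IsDiagonalOf a b (p , q) = Within a b (p , q) × suc p < q × ¬ (p ≡ a × q ≡ b)

chord-within : ∀ {a b} (t : Tree a b) {x} → x ∈ chords t → Within a b x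
chord-within (node L R) (here refl) = ≤-refl , ≤-refl
chord-within (node L R) (there x∈) with ∈-diagonals⁻ L R x∈
... | inj₁ x∈L = let (a≤p , q≤k) = chord-within L x∈L in a≤p , ≤-trans q≤k (<⇒≤ (tree-< R))
... | inj₂ x∈R = let (k≤p , q≤b) = chord-within R x∈R in ≤-trans (<⇒≤ (tree-< L)) k≤p , q≤b

chord-long : ∀ {a b} (t : Tree a b) {p q} → (p , q) ∈ chords t → suc p < q
chord-long (node L R) (here refl) = ≤-<-trans (tree-< L) (tree-< R)
chord-long (node L R) (there x∈) with ∈-diagonals⁻ L R x∈
... | inj₁ x∈L = chord-long L x∈L
... | inj₂ x∈R = chord-long R x∈R

diagonal-isDiagonalOf : ∀ {a b} (t : Tree a b) {x} → x ∈ diagonals t → IsDiagonalOf a b x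
diagonal-isDiagonalOf (node L R) x∈ =
  chord-within (node L R) (there x∈) , chord-long (node L R) (there x∈) , notRoot (∈-diagonals⁻ L R x∈)
  where
  notRoot : ∀ {p q} → (p , q) ∈ chords L ⊎ (p , q) ∈ chords R → ¬ (p ≡ _ × q ≡ _)
  notRoot (inj₁ x∈L) (_ , refl) = <⇒≱ (tree-< R) (proj₂ (chord-within L x∈L))
  notRoot (inj₂ x∈R) (refl , _) = <⇒≱ (tree-< L) (proj₁ (chord-within R x∈R))

chords-nonCrossing : ∀ {a b} (t : Tree a b) {x y} → x ∈ chords t → y ∈ chords t → ¬ Crosses x y
chords-nonCrossing t@(node L R) (here refl) y∈ =
  let (a≤p , q≤b) = chord-within t y∈ in nested⇒¬crosses a≤p q≤b
chords-nonCrossing t@(node L R) x∈@(there _) (here refl) =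
  let (a≤p , q≤b) = chord-within t x∈ in λ c → nested⇒¬crosses a≤p q≤b (crosses-sym c)
chords-nonCrossing (node L R) (there x∈) (there y∈) with ∈-diagonals⁻ L R x∈ | ∈-diagonals⁻ L R y∈
... | inj₁ x∈L | inj₁ y∈L = chords-nonCrossing L x∈L y∈L
... | inj₂ x∈R | inj₂ y∈R = chords-nonCrossing R x∈R y∈R
... | inj₁ x∈L | inj₂ y∈R = separated⇒¬crosses (≤-trans (proj₂ (chord-within L x∈L)) (proj₁ (chord-within R y∈R)))
... | inj₂ x∈R | inj₁ y∈L =
  separated⇒¬crosses (≤-trans (proj₂ (chord-within L y∈L)) (proj₁ (chord-within R x∈R))) ∘′ crosses-sym

chords-maximal : ∀ {a b} (t : Tree a b) {c d} → Within a b (c , d) → suc c < d → (c , d) ∉ chords t →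
                 ∃[ y ] (y ∈ chords t × Crosses (c , d) y)
chords-maximal leaf (a≤c , d≤1+a) c+1<d _ = contradiction d≤1+a (<⇒≱ (≤-trans (s≤s (s≤s a≤c)) c+1<d))
chords-maximal (node {a} {k} {b} L R) {c} {d} (a≤c , d≤b) c+1<d ∉t with d ≤? k | k ≤? c
... | yes d≤k | _ = let (y , y∈ , cr) = chords-maximal L (a≤c , d≤k) c+1<d (∉t ∘′ there ∘′ ∈-diagonals⁺ˡ L R) in
                    y , there (∈-diagonals⁺ˡ L R y∈) , cr
... | no _ | yes k≤c = let (y , y∈ , cr) = chords-maximal R (k≤c , d≤b) c+1<d (∉t ∘′ there ∘′ ∈-diagonals⁺ʳ L R) in
                       y , there (∈-diagonals⁺ʳ L R y∈) , cr
... | no d≰k | no k≰c with c ≟ a | d ≟ b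
...   | yes refl | yes refl = contradiction (here refl) ∉t
...   | yes refl | no d≢b =
  (k , b) , there (∈-diagonals⁺ʳ L R (root∈chords R (<-≤-trans (s≤s k<d) d<b))) , inj₁ (tree-< L , k<d , d<b)
  where
  k<d = ≰⇒> d≰k
  d<b = ≤∧≢⇒< d≤b d≢b
...   | no c≢a | _ =
  (a , k) , there (∈-diagonals⁺ˡ L R (root∈chords L (≤-trans (s≤s a<c) c<k))) , inj₂ (a<c , c<k , ≰⇒> d≰k)
  where
  a<c = ≤∧≢⇒< a≤c (c≢a ∘′ sym)
  c<k = ≰⇒> k≰c

diagonals-maximal : ∀ {a b} (t : Tree a b) {x} → IsDiagonalOf a b x → x ∉ diagonals t →
                    ∃[ y ] (y ∈ diagonals t × Crosses x y)
diagonals-maximal leaf (within , c+1<d , _) _ with chords-maximal leaf within c+1<d (λ ())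
... | _ , () , _
diagonals-maximal (node L R) (within , c+1<d , notRoot) ∉t
  with chords-maximal (node L R) within c+1<d (λ { (here refl) → notRoot (refl , refl) ; (there x∈) → ∉t x∈ })
... | _ , here refl , cr = contradiction (crosses-sym cr) (nested⇒¬crosses (proj₁ within) (proj₂ within))
... | y , there y∈ , cr = y , y∈ , cr

edges : ∀ {a b} → Tree a b → List Edge
edges (leaf {a}) = (a , suc a) ∷ []
edges (node {a} {_} {b} L R) = (a , b) ∷ edges L ++ edges R

root∈edges : ∀ {a b} (t : Tree a b) → (a , b) ∈ edges t
root∈edges leaf = here refl
root∈edges (node _ _) = here refl

∈-edges⁻ : ∀ {a k b} (L : Tree a k) (R : Tree k b) {x} →
           x ∈ edges (node L R) → x ≡ (a , b) ⊎ x ∈ edges L ⊎ x ∈ edges R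
∈-edges⁻ L R (here refl) = inj₁ refl
∈-edges⁻ L R (there x∈) = inj₂ (∈-++⁻ (edges L) x∈)

edge-within : ∀ {a b} (t : Tree a b) {x} → x ∈ edges t → Within a b x
edge-within leaf (here refl) = ≤-refl , ≤-refl
edge-within (node L R) x∈ with ∈-edges⁻ L R x∈
... | inj₁ refl = ≤-refl , ≤-refl
... | inj₂ (inj₁ x∈L) = let (a≤p , q≤k) = edge-within L x∈L in a≤p , ≤-trans q≤k (<⇒≤ (tree-< R))
... | inj₂ (inj₂ x∈R) = let (k≤p , q≤b) = edge-within R x∈R in ≤-trans (<⇒≤ (tree-< L)) k≤p , q≤b

chord∈edges : ∀ {a b} (t : Tree a b) {x} → x ∈ chords t → x ∈ edges t
chord∈edges (node L R) (here refl) = here refl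
chord∈edges (node L R) (there x∈) with ∈-diagonals⁻ L R x∈
... | inj₁ x∈L = there (∈-++⁺ˡ (chord∈edges L x∈L))
... | inj₂ x∈R = there (∈-++⁺ʳ (edges L) (chord∈edges R x∈R))

side∈edges : ∀ {a b} (t : Tree a b) {i} → a ≤ i → i < b → (i , suc i) ∈ edges t
side∈edges (leaf {a}) {i} a≤i i<1+a = here (cong (λ j → j , suc j) (≤-antisym (≤-pred i<1+a) a≤i))
side∈edges (node {k = k} L R) {i} a≤i i<b with i <? k
... | yes i<k = there (∈-++⁺ˡ (side∈edges L a≤i i<k))
... | no i≮k = there (∈-++⁺ʳ (edges L) (side∈edges R (≮⇒≥ i≮k) i<b))

edge-sideOrChord : ∀ {a b} (t : Tree a b) {u w} → (u , w) ∈ edges t → w ≡ suc u ⊎ (u , w) ∈ chords t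
edge-sideOrChord leaf (here refl) = inj₁ refl
edge-sideOrChord (node L R) x∈ with ∈-edges⁻ L R x∈
... | inj₁ refl = inj₂ (here refl)
... | inj₂ (inj₁ x∈L) = Data.Sum.map₂ (there ∘′ ∈-diagonals⁺ˡ L R) (edge-sideOrChord L x∈L)
... | inj₂ (inj₂ x∈R) = Data.Sum.map₂ (there ∘′ ∈-diagonals⁺ʳ L R) (edge-sideOrChord R x∈R)

edge-< : ∀ {a b} (t : Tree a b) {u w} → (u , w) ∈ edges t → u < w
edge-< t x∈ with edge-sideOrChord t x∈
... | inj₁ refl = ≤-refl
... | inj₂ x∈chords = <-trans ≤-refl (chord-long t x∈chords)

-- Triangle t p k q : the triangle of t on the base (p , q) has apex k.
data Triangle : ∀ {a b} → Tree a b → ℕ → ℕ → ℕ → Set where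
  root    : ∀ {a k b} {L : Tree a k} {R : Tree k b} → Triangle (node L R) a k b
  inLeft  : ∀ {a c b p k q} {L : Tree a c} {R : Tree c b} → Triangle L p k q → Triangle (node L R) p k q
  inRight : ∀ {a c b p k q} {L : Tree a c} {R : Tree c b} → Triangle R p k q → Triangle (node L R) p k q

triangle-bounds : ∀ {a b p k q} {t : Tree a b} → Triangle t p k q → a ≤ p × p < k × k < q × q ≤ b
triangle-bounds (root {L = L} {R}) = ≤-refl , tree-< L , tree-< R , ≤-refl
triangle-bounds (inLeft {R = R} tri) =
  let (a≤p , p<k , k<q , q≤c) = triangle-bounds tri in a≤p , p<k , k<q , ≤-trans q≤c (<⇒≤ (tree-< R))
triangle-bounds (inRight {L = L} tri) =
  let (c≤p , p<k , k<q , q≤b) = triangle-bounds tri in ≤-trans (<⇒≤ (tree-< L)) c≤p , p<k , k<q , q≤b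

triangle-edges : ∀ {a b p k q} {t : Tree a b} → Triangle t p k q → (p , k) ∈ edges t × (k , q) ∈ edges t
triangle-edges (root {L = L}) = there (∈-++⁺ˡ (root∈edges L)) , there (∈-++⁺ʳ (edges L) (root∈edges _))
triangle-edges (inLeft tri) = let (pk∈ , kq∈) = triangle-edges tri in there (∈-++⁺ˡ pk∈) , there (∈-++⁺ˡ kq∈)
triangle-edges (inRight {L = L} tri) =
  let (pk∈ , kq∈) = triangle-edges tri in there (∈-++⁺ʳ (edges L) pk∈) , there (∈-++⁺ʳ (edges L) kq∈)

triangle-neighbour : ∀ {a b p k q u} {t : Tree a b} → Triangle t p k q →
                     (u , k) ∈ edges t ⊎ (k , u) ∈ edges t → p ≤ u × u ≤ q
triangle-neighbour {t = t} root (inj₁ uk∈) =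
  proj₁ (edge-within t uk∈) , <⇒≤ (<-≤-trans (edge-< t uk∈) (proj₂ (edge-within t uk∈)))
triangle-neighbour {t = t} root (inj₂ ku∈) =
  ≤-trans (proj₁ (edge-within t ku∈)) (<⇒≤ (edge-< t ku∈)) , proj₂ (edge-within t ku∈)
triangle-neighbour (inLeft {L = L} {R} tri) (inj₁ uk∈) with triangle-bounds tri | ∈-edges⁻ L R uk∈
... | _ , _ , k<q , q≤c | inj₁ refl = contradiction (<-≤-trans k<q q≤c) (<-asym (tree-< R))
... | _ | inj₂ (inj₁ uk∈L) = triangle-neighbour tri (inj₁ uk∈L)
... | _ , _ , k<q , q≤c | inj₂ (inj₂ uk∈R) =
  contradiction (<-≤-trans k<q q≤c) (<-asym (≤-<-trans (proj₁ (edge-within R uk∈R)) (edge-< R uk∈R)))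
triangle-neighbour (inLeft {L = L} {R} tri) (inj₂ ku∈) with triangle-bounds tri | ∈-edges⁻ L R ku∈
... | a≤p , p<k , _ | inj₁ refl = contradiction (≤-<-trans a≤p p<k) (<-irrefl refl)
... | _ | inj₂ (inj₁ ku∈L) = triangle-neighbour tri (inj₂ ku∈L)
... | _ , _ , k<q , q≤c | inj₂ (inj₂ ku∈R) = contradiction (proj₁ (edge-within R ku∈R)) (<⇒≱ (<-≤-trans k<q q≤c))
triangle-neighbour (inRight {L = L} {R} tri) (inj₁ uk∈) with triangle-bounds tri | ∈-edges⁻ L R uk∈
... | _ , _ , k<q , q≤b | inj₁ refl = contradiction (<-≤-trans k<q q≤b) (<-irrefl refl)
... | c≤p , p<k , _ | inj₂ (inj₁ uk∈L) = contradiction (proj₂ (edge-within L uk∈L)) (<⇒≱ (≤-<-trans c≤p p<k))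
... | _ | inj₂ (inj₂ uk∈R) = triangle-neighbour tri (inj₁ uk∈R)
triangle-neighbour (inRight {L = L} {R} tri) (inj₂ ku∈) with triangle-bounds tri | ∈-edges⁻ L R ku∈
... | c≤p , p<k , _ | inj₁ refl = contradiction (<-trans (tree-< L) (≤-<-trans c≤p p<k)) (<-irrefl refl)
... | c≤p , p<k , _ | inj₂ (inj₁ ku∈L) =
  contradiction (≤-trans (<⇒≤ (edge-< L ku∈L)) (proj₂ (edge-within L ku∈L))) (<⇒≱ (≤-<-trans c≤p p<k))
... | _ | inj₂ (inj₂ ku∈R) = triangle-neighbour tri (inj₂ ku∈R)

size : ∀ {a b} → Tree a b → ℕ
size leaf = 0
size (node L R) = size L + suc (size R)

inorder : ∀ {a b} → Tree a b → List ℕ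
inorder leaf = []
inorder (node {k = k} L R) = inorder L ++ k ∷ inorder R

postorder : ∀ {a b} → Tree a b → List ℕ
postorder leaf = []
postorder (node {k = k} L R) = postorder L ++ postorder R ++ k ∷ []

Between : ℕ → ℕ → ℕ → Set
Between a b x = a < x × x < b

inorder-between : ∀ {a b} (t : Tree a b) → All (Between a b) (inorder t)
inorder-between leaf = []
inorder-between (node L R) =
  All.++⁺ (All.map (λ (a<x , x<k) → a<x , <-trans x<k (tree-< R)) (inorder-between L))
          ((tree-< L , tree-< R) ∷ All.map (λ (k<x , x<b) → <-trans (tree-< L) k<x , x<b) (inorder-between R))

inorder-sorted : ∀ {a b} (t : Tree a b) → Sorted (inorder t)
inorder-sorted leaf = []
inorder-sorted (node L R) = AllPairs.++⁺ (inorder-sorted L)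
  (All.map proj₁ (inorder-between R) ∷ inorder-sorted R)
  (All.map (λ (_ , x<k) → x<k ∷ All.map (λ (k<y , _) → <-trans x<k k<y) (inorder-between R)) (inorder-between L))

tree-size : ∀ {a b} (t : Tree a b) → b ≡ suc (a + size t)
tree-size {a} leaf = cong suc (sym (+-identityʳ a))
tree-size {a} (node {k = k} L R) = begin
  _                                 ≡⟨ tree-size R ⟩
  suc (k + size R)                  ≡⟨ cong (λ c → suc (c + size R)) (tree-size L) ⟩
  suc (suc (a + size L) + size R)   ≡⟨ cong suc (+-suc (a + size L) (size R)) ⟨
  suc (a + size L + suc (size R))   ≡⟨ cong suc (+-assoc a (size L) (suc (size R))) ⟩
  suc (a + (size L + suc (size R))) ∎
  where open ≡-Reasoning

inorder≡range : ∀ {a b} (t : Tree a b) → inorder t ≡ range (suc a) (size t)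
inorder≡range leaf = refl
inorder≡range {a} (node {k = k} L R) = begin
  inorder L ++ k ∷ inorder R
    ≡⟨ cong₂ (λ xs ys → xs ++ k ∷ ys) (inorder≡range L) (inorder≡range R) ⟩
  range (suc a) (size L) ++ range k (suc (size R))
    ≡⟨ cong (λ c → range (suc a) (size L) ++ range c (suc (size R))) (tree-size L) ⟩
  range (suc a) (size L) ++ range (suc a + size L) (suc (size R))
    ≡⟨ range-++ (suc a) (size L) (suc (size R)) ⟨
  range (suc a) (size L + suc (size R)) ∎
  where open ≡-Reasoning

-- Triangulations of the polygon

module Polygon (m : ℕ) where

  N : ℕ
  N = suc (suc m)

  -- Tree vertex 0 stands for the polygon vertex N, so the root side (0 , m + 1) of a tree is the
  -- side (m + 1 , N) and its inner vertices 1 … m are the clip labels.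
  lab : ℕ → ℕ
  lab zero = N
  lab (suc i) = suc i

  relabel : Edge → Edge
  relabel (zero , j) = (j , N)
  relabel (suc i , j) = (suc i , j)

  unrelabel : Edge → Edge
  unrelabel (i , j) with j ≟ N
  ... | yes _ = (0 , i)
  ... | no _ = (i , j)

  lab-injective : ∀ {u w} → u ≤ suc m → w ≤ suc m → lab u ≡ lab w → u ≡ w
  lab-injective {zero} {zero} _ _ _ = refl
  lab-injective {zero} {suc w} _ w≤ N≡w = contradiction (subst (_≤ suc m) (sym N≡w) w≤) 1+n≰n
  lab-injective {suc u} {zero} u≤ _ u≡N = contradiction (subst (_≤ suc m) u≡N u≤) 1+n≰n
  lab-injective {suc u} {suc w} _ _ u≡w = u≡w

  relabel-lab : ∀ {u w} → 0 < w → relabel (u , w) ≡ (lab u , lab w) ⊎ relabel (u , w) ≡ (lab w , lab u)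
  relabel-lab {zero} {suc w} _ = inj₂ refl
  relabel-lab {suc u} {suc w} _ = inj₁ refl

  lab-positive : ∀ {u} → 0 < u → lab u ≡ u
  lab-positive {suc u} _ = refl

  lab-≢ : ∀ {u w} → u < w → w ≤ suc m → lab u ≢ lab w
  lab-≢ u<w w≤ eq = <⇒≢ u<w (lab-injective (<⇒≤ (<-≤-trans u<w w≤)) w≤ eq)

  Proper : Edge → Set
  Proper (p , q) = p < q × q ≤ suc m

  IsDiagonalᵀ : Edge → Set
  IsDiagonalᵀ = IsDiagonalOf 0 (suc m)

  isDiagonalᵀ⇒proper : ∀ {x} → IsDiagonalᵀ x → Proper x
  isDiagonalᵀ⇒proper ((_ , q≤) , p+1<q , _) = <-trans ≤-refl p+1<q , q≤

  relabel-isDiagonal : ∀ x → IsDiagonalᵀ x → IsDiagonal N (relabel x)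
  relabel-isDiagonal (zero , q) ((_ , q≤) , 1<q , notRoot) =
    ≤-trans (s≤s z≤n) 1<q ,
    subst (_≤ N) (+-comm 2 q) (s≤s (s≤s (≤-pred (≤∧≢⇒< q≤ (notRoot ∘′ (refl ,_)))))) ,
    ≤-refl , λ { (refl , _) → <-irrefl refl 1<q }
  relabel-isDiagonal (suc p , q) ((_ , q≤) , p+1<q , _) =
    s≤s z≤n , subst (_≤ q) (+-comm 2 (suc p)) p+1<q , m≤n⇒m≤1+n q≤ ,
    λ { (_ , refl) → <-irrefl refl (s≤s q≤) }

  unrelabel-isDiagonalᵀ : ∀ e → IsDiagonal N e → IsDiagonalᵀ (unrelabel e) × relabel (unrelabel e) ≡ e
  unrelabel-isDiagonalᵀ (i , j) (1≤i , i+2≤j , j≤N , notSide) with j ≟ N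
  ... | yes refl = let i+2≤N = subst (_≤ N) (+-comm i 2) i+2≤j in
    ((z≤n , m≤n⇒m≤1+n (≤-pred (≤-pred i+2≤N))) , ≤∧≢⇒< 1≤i (notSide ∘′ (_, refl) ∘′ sym) ,
      λ { (_ , refl) → <-irrefl refl (≤-pred i+2≤N) }) , refl
  unrelabel-isDiagonalᵀ (suc i , j) (1≤i , i+2≤j , j≤N , notSide) | no j≢N =
    ((z≤n , ≤-pred (≤∧≢⇒< j≤N j≢N)) , subst (_≤ j) (+-comm (suc i) 2) i+2≤j , λ { (() , _) }) , refl

  relabel-crosses : ∀ {x y} → Proper x → Proper y → Crosses x y → Crosses (relabel x) (relabel y)
  relabel-crosses {zero , _} {zero , _} _ _ (inj₁ (() , _))
  relabel-crosses {zero , _} {zero , _} _ _ (inj₂ (() , _))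
  relabel-crosses {zero , _} {suc _ , _} _ (_ , s≤) (inj₁ (_ , r<q , q<s)) = inj₂ (r<q , q<s , s≤s s≤)
  relabel-crosses {zero , _} {suc _ , _} _ _ (inj₂ (() , _))
  relabel-crosses {suc _ , _} {zero , _} _ _ (inj₁ (() , _))
  relabel-crosses {suc _ , _} {zero , _} (_ , q≤) _ (inj₂ (_ , p<s , s<q)) = inj₁ (p<s , s<q , s≤s q≤)
  relabel-crosses {suc _ , _} {suc _ , _} _ _ c = c

  relabel-crosses⁻ : ∀ {x y} → Proper x → Proper y → Crosses (relabel x) (relabel y) → Crosses x y
  relabel-crosses⁻ {zero , _} {zero , _} _ _ (inj₁ (_ , _ , N<N)) = contradiction N<N (<-irrefl refl)
  relabel-crosses⁻ {zero , _} {zero , _} _ _ (inj₂ (_ , _ , N<N)) = contradiction N<N (<-irrefl refl)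
  relabel-crosses⁻ {zero , _} {suc _ , _} _ (_ , s≤) (inj₁ (_ , _ , N<s)) = contradiction (m≤n⇒m≤1+n s≤) (<⇒≱ N<s)
  relabel-crosses⁻ {zero , _} {suc _ , _} _ _ (inj₂ (r<q , q<s , _)) = inj₁ (s≤s z≤n , r<q , q<s)
  relabel-crosses⁻ {suc _ , _} {zero , _} _ _ (inj₁ (p<s , s<q , _)) = inj₂ (s≤s z≤n , p<s , s<q)
  relabel-crosses⁻ {suc _ , _} {zero , _} (_ , q≤) _ (inj₂ (_ , _ , N<q)) = contradiction (m≤n⇒m≤1+n q≤) (<⇒≱ N<q)
  relabel-crosses⁻ {suc _ , _} {suc _ , _} _ _ c = c

  triangulationOf : ∀ {a b} → Tree a b → List Edge
  triangulationOf t = map relabel (diagonals t)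

  triangulationOf-isTriangulation : (t : Tree 0 (suc m)) → IsTriangulation N (triangulationOf t)
  triangulationOf-isTriangulation t = All.tabulate isDiagonal , nonCrossing , maximal
    where
    isDiagonal : ∀ {e} → e ∈ triangulationOf t → IsDiagonal N e
    isDiagonal e∈ with ∈-map⁻ relabel e∈
    ... | x , x∈ , refl = relabel-isDiagonal x (diagonal-isDiagonalOf t x∈)
    proper : ∀ {x} → x ∈ diagonals t → Proper x
    proper = isDiagonalᵀ⇒proper ∘′ diagonal-isDiagonalOf t
    nonCrossing : ∀ d e → d ∈ triangulationOf t → e ∈ triangulationOf t → ¬ Crosses d e
    nonCrossing _ _ d∈ e∈ cr with ∈-map⁻ relabel d∈ | ∈-map⁻ relabel e∈
    ... | x , x∈ , refl | y , y∈ , refl =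
      chords-nonCrossing t (diagonals⊆chords t x∈) (diagonals⊆chords t y∈)
        (relabel-crosses⁻ (proper x∈) (proper y∈) cr)
    maximal : ∀ d → IsDiagonal N d → d ∉ triangulationOf t → ∃[ e ] (e ∈ triangulationOf t × Crosses d e)
    maximal d isDiag d∉ with unrelabel-isDiagonalᵀ d isDiag
    ... | diagᵀ , eq with diagonals-maximal t diagᵀ (d∉ ∘′ subst (_∈ _) eq ∘′ ∈-map⁺ relabel)
    ...   | y , y∈ , cr =
      relabel y , ∈-map⁺ relabel y∈ ,
      subst (λ x → Crosses x (relabel y)) eq (relabel-crosses (isDiagonalᵀ⇒proper diagᵀ) (proper y∈) cr)

  module _ (D : List Edge) (isTri : IsTriangulation N D) where
    private
      open DecMembership (≡-dec _≟_ _≟_) using (_∈?_)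

      Present : Edge → Set
      Present x = relabel x ∈ D

      present-nonCrossing : ∀ {x y} → Proper x → Proper y → Present x → Present y → ¬ Crosses x y
      present-nonCrossing px py x∈ y∈ = proj₁ (proj₂ isTri) _ _ x∈ y∈ ∘′ relabel-crosses px py

      present-maximal : ∀ {x} → IsDiagonalᵀ x → ¬ Present x → ∃[ y ] (Proper y × Present y × Crosses x y)
      present-maximal {x} diag x∉ with proj₂ (proj₂ isTri) (relabel x) (relabel-isDiagonal x diag) x∉
      ... | e , e∈ , cr with unrelabel-isDiagonalᵀ e (All.lookup (proj₁ isTri) e∈)
      ...   | diagᵀ , eq = unrelabel e , isDiagonalᵀ⇒proper diagᵀ , subst (_∈ D) (sym eq) e∈ ,
                           relabel-crosses⁻ (isDiagonalᵀ⇒proper diag) (isDiagonalᵀ⇒proper diagᵀ)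
                             (subst (Crosses (relabel x)) (sym eq) cr)

      -- (a , b) is a side of the polygon (the last case being the side (m + 1 , N)) or a diagonal of D
      InGraph : ℕ → ℕ → Set
      InGraph a b = b ≡ suc a ⊎ Present (a , b) ⊎ (a ≡ 0 × b ≡ suc m)

      inGraph-present : ∀ {a b} → InGraph a b → suc a < b → ¬ (a ≡ 0 × b ≡ suc m) → Present (a , b)
      inGraph-present (inj₁ refl) 1+a<1+a _ = contradiction 1+a<1+a (<-irrefl refl)
      inGraph-present (inj₂ (inj₁ ab∈)) _ _ = ab∈
      inGraph-present (inj₂ (inj₂ side)) _ notSide = contradiction side notSide

      inGraph-nonCrossing : ∀ {a b y} → a < b → b ≤ suc m → InGraph a b → Proper y → Present y →
                            ¬ Crosses (a , b) y
      inGraph-nonCrossing _ _ (inj₁ refl) _ _ (inj₁ (a<x , x<1+a , _)) = <⇒≱ a<x (≤-pred x<1+a)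
      inGraph-nonCrossing _ _ (inj₁ refl) _ _ (inj₂ (_ , a<y , y<1+a)) = <⇒≱ a<y (≤-pred y<1+a)
      inGraph-nonCrossing a<b b≤ (inj₂ (inj₁ ab∈)) py y∈ = present-nonCrossing (a<b , b≤) py ab∈ y∈
      inGraph-nonCrossing _ _ (inj₂ (inj₂ (refl , refl))) (_ , y≤) _ (inj₁ (_ , _ , 1+m<y)) = <⇒≱ 1+m<y y≤
      inGraph-nonCrossing _ _ (inj₂ (inj₂ (refl , refl))) _ _ (inj₂ (() , _))

      -- The apex of the triangle on the edge (a , b) is the last neighbour k of a before b:
      -- a diagonal crossing (k , b) would cross (a , b), (a , k) or end at a later neighbour of a.
      triangle-on : ∀ {a h} → suc a < suc h → suc h ≤ suc m → InGraph a (suc h) →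
                    ∃[ k ] (a < k × k < suc h × InGraph a k × InGraph k (suc h))
      triangle-on {a} {h} 1+a<b b≤ ab
        with greatest-satisfying (λ j → (j ≟ suc a) ⊎-dec (relabel (a , j) ∈? D))
                                 (≤⇒≤′ (≤-pred 1+a<b)) (inj₁ refl)
      ... | k , a<k , k≤h , ak , noLaterNeighbour = k , a<k , s≤s k≤h , Data.Sum.map₂ inj₁ ak , kb
        where
        b = suc h
        k<b = s≤s k≤h
        kb-nonCrossing : ∀ {y} → Proper y → Present y → ¬ Crosses (k , b) y
        kb-nonCrossing py y∈ (inj₁ (k<x , x<b , b<y)) =
          inGraph-nonCrossing (<-trans a<k k<b) b≤ ab py y∈ (inj₁ (<-trans a<k k<x , x<b , b<y))
        kb-nonCrossing {x , y} py y∈ (inj₂ (x<k , k<y , y<b)) with <-cmp x a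
        ... | tri< x<a _ _ =
          inGraph-nonCrossing (<-trans a<k k<b) b≤ ab py y∈ (inj₂ (x<a , <-trans a<k k<y , y<b))
        ... | tri≈ _ refl _ = noLaterNeighbour k<y (≤-pred y<b) (inj₂ y∈)
        ... | tri> _ _ a<x =
          inGraph-nonCrossing a<k (≤-trans (<⇒≤ k<b) b≤) (Data.Sum.map₂ inj₁ ak) py y∈ (inj₁ (a<x , x<k , k<y))
        kb : InGraph k b
        kb with b ≟ suc k | relabel (k , b) ∈? D
        ... | yes b≡1+k | _ = inj₁ b≡1+k
        ... | no _ | yes kb∈ = inj₂ (inj₁ kb∈)
        ... | no b≢1+k | no kb∉ =
          let (y , py , y∈ , cr) = present-maximal ((z≤n , b≤) , ≤∧≢⇒< k<b (b≢1+k ∘′ sym) ,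
                                      λ (k≡0 , _) → contradiction (subst (a <_) k≡0 a<k) (λ ())) kb∉
          in contradiction cr (kb-nonCrossing py y∈)

      build : ∀ f a b → a < b → b ≤ a + f → b ≤ suc m → InGraph a b → Σ (Tree a b) (All Present ∘′ diagonals)
      build zero a b a<b b≤a+0 _ _ = contradiction (subst (b ≤_) (+-identityʳ a) b≤a+0) (<⇒≱ a<b)
      build (suc f) a (suc h) a<b b≤a+1+f b≤ ab with h ≟ a
      ... | yes refl = leaf , []
      ... | no h≢a with triangle-on (s≤s (≤∧≢⇒< (≤-pred a<b) (h≢a ∘′ sym))) b≤ ab
      ...   | k , a<k , k<b , ak , kb =
        node (proj₁ Lᵖ) (proj₁ Rᵖ) ,
        All.++⁺ (chords-all (proj₁ Lᵖ) presentᴸ (proj₂ Lᵖ)) (chords-all (proj₁ Rᵖ) presentᴿ (proj₂ Rᵖ))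
        where
        presentᴸ : suc a < k → Present (a , k)
        presentᴸ 1+a<k = inGraph-present ak 1+a<k λ (_ , k≡1+m) → <⇒≱ (subst (_< suc h) k≡1+m k<b) b≤
        presentᴿ : suc k < suc h → Present (k , suc h)
        presentᴿ 1+k<b = inGraph-present kb 1+k<b λ (k≡0 , _) → <⇒≱ (subst (a <_) k≡0 a<k) z≤n
        b≤1+a+f = subst (suc h ≤_) (+-suc a f) b≤a+1+f
        Lᵖ = build f a k a<k (≤-pred (<-≤-trans k<b b≤1+a+f)) (≤-trans (<⇒≤ k<b) b≤) ak
        Rᵖ = build f k (suc h) k<b (≤-trans b≤1+a+f (+-monoˡ-≤ f a<k)) b≤ kb

    triangulationOf-complete : Σ (Tree 0 (suc m)) λ t → ∀ e → e ∈ D ⇔ e ∈ triangulationOf t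
    triangulationOf-complete = t , λ e → mk⇔ (to e) (from e)
      where
      built = build (suc m) 0 (suc m) (s≤s z≤n) ≤-refl ≤-refl (inj₂ (inj₂ (refl , refl)))
      t = proj₁ built
      from : ∀ e → e ∈ triangulationOf t → e ∈ D
      from e e∈ with ∈-map⁻ relabel e∈
      ... | x , x∈ , refl = All.lookup (proj₂ built) x∈
      -- a diagonal of D missing from the maximal family triangulationOf t would cross one of its members
      to : ∀ e → e ∈ D → e ∈ triangulationOf t
      to e e∈ with e ∈? triangulationOf t
      ... | yes e∈t = e∈t
      ... | no e∉t with proj₂ (proj₂ (triangulationOf-isTriangulation t)) e (All.lookup (proj₁ isTri) e∈) e∉t
      ...   | f , f∈t , cr = contradiction cr (proj₁ (proj₂ isTri) e f e∈ (from f f∈t))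

-- Clip sequences are postorders

module Clipping (m : ℕ) (t : Tree 0 (suc m)) (D : List Edge)
                (D≈t : ∀ e → e ∈ D ⇔ e ∈ Polygon.triangulationOf m t) where
  open Polygon m

  E : List Edge
  E = graphEdges N D

  ∈E⇒edge : ∀ {e} → e ∈ E → ∃[ x ] (x ∈ edges t × e ≡ relabel x)
  ∈E⇒edge (here refl) = (0 , 1) , side∈edges t z≤n (s≤s z≤n) , refl
  ∈E⇒edge (there e∈) with ∈-++⁻ (map (λ i → (i , suc i)) (range 1 (suc m))) e∈
  ... | inj₂ e∈D with ∈-map⁻ relabel (Equivalence.to (D≈t _) e∈D)
  ...   | x , x∈ , refl = x , chord∈edges t (diagonals⊆chords t x∈) , refl
  ∈E⇒edge (there e∈) | inj₁ e∈sides with ∈-map⁻ (λ i → (i , suc i)) e∈sides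
  ... | zero , i∈ , refl = contradiction (proj₁ (∈-range⁻ 1 (suc m) i∈)) λ ()
  ... | suc i , i∈ , refl with i ≟ m
  ...   | yes refl = (0 , suc m) , root∈edges t , refl
  ...   | no i≢m =
    (suc i , suc (suc i)) , side∈edges t z≤n (s≤s (≤∧≢⇒< (≤-pred (≤-pred (proj₂ (∈-range⁻ 1 (suc m) i∈)))) i≢m)) , refl

  side∈E : ∀ {i} → i ≤ m → relabel (i , suc i) ∈ E
  side∈E {zero} _ = here refl
  side∈E {suc i} 1+i≤m =
    there (∈-++⁺ˡ (∈-map⁺ (λ j → (j , suc j)) (∈-range⁺ 1 (suc m) (s≤s z≤n) (s≤s (m≤n⇒m≤1+n 1+i≤m)))))

  edge⇒∈E : ∀ {x} → x ∈ edges t → relabel x ∈ E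
  edge⇒∈E x∈ with edge-sideOrChord t x∈
  ... | inj₁ refl = side∈E (≤-pred (proj₂ (edge-within t x∈)))
  ... | inj₂ x∈chords with chord-rootOrDiagonal t x∈chords
  ...   | inj₁ refl = there (∈-++⁺ˡ (∈-map⁺ (λ i → (i , suc i)) (∈-range⁺ 1 (suc m) (s≤s z≤n) ≤-refl)))
  ...   | inj₂ x∈diag = there (∈-++⁺ʳ _ (Equivalence.from (D≈t _) (∈-map⁺ relabel x∈diag)))

  Adjacentᵀ : ℕ → ℕ → Set
  Adjacentᵀ u w = (u , w) ∈ edges t ⊎ (w , u) ∈ edges t

  adjacentᵀ-≢ : ∀ {u w} → Adjacentᵀ u w → u ≢ w
  adjacentᵀ-≢ (inj₁ uw∈) refl = <-irrefl refl (edge-< t uw∈)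
  adjacentᵀ-≢ (inj₂ wu∈) refl = <-irrefl refl (edge-< t wu∈)

  adjacentᵀ-bounded : ∀ {u w} → Adjacentᵀ u w → u ≤ suc m × w ≤ suc m
  adjacentᵀ-bounded (inj₁ uw∈) = let (_ , w≤) = edge-within t uw∈ in <⇒≤ (<-≤-trans (edge-< t uw∈) w≤) , w≤
  adjacentᵀ-bounded (inj₂ wu∈) = let (_ , u≤) = edge-within t wu∈ in u≤ , <⇒≤ (<-≤-trans (edge-< t wu∈) u≤)

  ∈E⇒labelled : ∀ {y z} → (y , z) ∈ E → ∃[ u ] ∃[ w ] (y ≡ lab u × z ≡ lab w × Adjacentᵀ u w)
  ∈E⇒labelled yz∈ with ∈E⇒edge yz∈
  ... | (u , w) , uw∈ , eq with relabel-lab {u} (≤-<-trans z≤n (edge-< t uw∈))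
  ...   | inj₁ eq′ = let (y≡ , z≡) = ×-≡,≡←≡ (trans eq eq′) in u , w , y≡ , z≡ , inj₁ uw∈
  ...   | inj₂ eq′ = let (y≡ , z≡) = ×-≡,≡←≡ (trans eq eq′) in w , u , y≡ , z≡ , inj₂ uw∈

  adjacent-lab : ∀ {u w} → Adjacentᵀ u w → T (adjacent E (lab u) (lab w))
  adjacent-lab (inj₁ uw∈) with relabel-lab (≤-<-trans z≤n (edge-< t uw∈))
  ... | inj₁ eq = adjacent⁺ E (inj₁ (subst (_∈ E) eq (edge⇒∈E uw∈)))
  ... | inj₂ eq = adjacent⁺ E (inj₂ (subst (_∈ E) eq (edge⇒∈E uw∈)))
  adjacent-lab (inj₂ wu∈) with relabel-lab (≤-<-trans z≤n (edge-< t wu∈))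
  ... | inj₁ eq = adjacent⁺ E (inj₂ (subst (_∈ E) eq (edge⇒∈E wu∈)))
  ... | inj₂ eq = adjacent⁺ E (inj₁ (subst (_∈ E) eq (edge⇒∈E wu∈)))

  adjacent-unlab : ∀ {x w} → w ≤ suc m → T (adjacent E x (lab w)) → ∃[ u ] (x ≡ lab u × Adjacentᵀ u w)
  adjacent-unlab w≤ adj with adjacent⁻ E adj
  ... | inj₁ xw∈ = let (u , w′ , x≡ , w≡ , adjᵀ) = ∈E⇒labelled xw∈
                       w′≡w = lab-injective (proj₂ (adjacentᵀ-bounded adjᵀ)) w≤ (sym w≡) in
                   u , x≡ , subst (Adjacentᵀ u) w′≡w adjᵀ
  ... | inj₂ wx∈ = let (w′ , u , w≡ , x≡ , adjᵀ) = ∈E⇒labelled wx∈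
                       w′≡w = lab-injective (proj₁ (adjacentᵀ-bounded adjᵀ)) w≤ (sym w≡) in
                   u , x≡ , subst (Adjacentᵀ u) w′≡w (Data.Sum.swap adjᵀ)

  ¬adjacent-self : ∀ {x} → ¬ T (adjacent E x x)
  ¬adjacent-self {x} adj = [ noLoop , noLoop ]′ (adjacent⁻ E {x} {x} adj)
    where
    noLoop : ∀ {x} → ¬ (x , x) ∈ E
    noLoop xx∈ = let (u , w , x≡u , x≡w , adjᵀ) = ∈E⇒labelled xx∈ ; (u≤ , w≤) = adjacentᵀ-bounded adjᵀ in
                 adjacentᵀ-≢ adjᵀ (lab-injective u≤ w≤ (trans (sym x≡u) x≡w))

  apex-positive : ∀ {p k q} → Triangle t p k q → 0 < k
  apex-positive tri = ≤-<-trans z≤n (proj₁ (proj₂ (triangle-bounds tri)))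

  apex-adjacent : ∀ {p k q} → Triangle t p k q → T (adjacent E (lab p) k) × T (adjacent E (lab q) k)
  apex-adjacent {p} {k} {q} tri =
    subst (λ v → T (adjacent E (lab p) v)) lab-k≡k (adjacent-lab (inj₁ (proj₁ (triangle-edges tri)))) ,
    subst (λ v → T (adjacent E (lab q) v)) lab-k≡k (adjacent-lab (inj₂ (proj₂ (triangle-edges tri))))
    where
    lab-k≡k = lab-positive (apex-positive tri)

  apex-neighbour : ∀ {p k q u} → Triangle t p k q → T (adjacent E u k) → u ≡ lab p ⊎ u ≡ lab q ⊎ Between p q u
  apex-neighbour {p} {k} {q} {u} tri adj
    with adjacent-unlab k≤ (subst (λ v → T (adjacent E u v)) (sym (lab-positive (apex-positive tri))) adj)
    where
    k≤ = let (_ , _ , k<q , q≤) = triangle-bounds tri in <⇒≤ (<-≤-trans k<q q≤)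
  ... | w , u≡lab-w , adjᵀ with triangle-neighbour tri adjᵀ | w ≟ p | w ≟ q
  ...   | _ | yes refl | _ = inj₁ u≡lab-w
  ...   | _ | no _ | yes refl = inj₂ (inj₁ u≡lab-w)
  ...   | p≤w , w≤q | no w≢p | no w≢q =
    let p<w = ≤∧≢⇒< p≤w (w≢p ∘′ sym) ; u≡w = trans u≡lab-w (lab-positive (≤-<-trans z≤n p<w)) in
    inj₂ (inj₂ (subst (p <_) (sym u≡w) p<w , subst (_< q) (sym u≡w) (≤∧≢⇒< w≤q w≢q)))

  -- The alive vertices outside the subpolygon a … b: pre below a and post above b, where N = lab 0 belongs.
  record Frame (a b : ℕ) (pre post : List ℕ) : Set where
    field
      pre-sorted  : Sorted pre
      post-sorted : Sorted post
      pre-≤       : All (_≤ a) pre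
      post-≥      : All (b ≤_) post
      lab-a∈      : lab a ∈ pre ++ post
      lab-b∈      : lab b ∈ pre ++ post

  ThreeNeighbours : List ℕ → ℕ → Set
  ThreeNeighbours alive p =
    ∃[ W ] (3 ≤ length W × Unique W × W ⊆ alive × All (λ w → T (adjacent E w p)) W)

  threeNeighbours-⊆ : ∀ {X Y p} → X ⊆ Y → ThreeNeighbours X p → ThreeNeighbours Y p
  threeNeighbours-⊆ X⊆Y (W , 3≤ , uniq , W⊆X , adj) = W , 3≤ , uniq , ⊆-trans W⊆X X⊆Y , adj

  threeNeighbours⇒degree≢2 : ∀ {alive p} → ThreeNeighbours alive p → degree E alive p ≢ 2
  threeNeighbours⇒degree≢2 (W , 3≤ , uniq , W⊆ , adj) deg≡2 =
    contradiction (subst (3 ≤_) deg≡2 (≤-trans 3≤ (degree-≥ E uniq W⊆ adj))) λ { (s≤s (s≤s ())) }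

  -- Until the apex of the subpolygon is clipped, each vertex of pre keeps three alive neighbours.
  Guarded : ∀ {a b} → List ℕ → Tree a b → List ℕ → Set
  Guarded pre leaf post = ⊤
  Guarded pre (node {k = k} _ _) post = All (ThreeNeighbours (pre ++ k ∷ post)) pre

  clip-apex : ∀ {a k b pre post} → Triangle t a k b → Frame a b pre post →
              All (ThreeNeighbours (pre ++ k ∷ post)) pre → ∀ j →
              clipSteps (suc j) E (pre ++ k ∷ post) ≡ Maybe.map (k ∷_) (clipSteps j E (pre ++ post))
  clip-apex {a} {k} {b} {pre} {post} tri frame guard j =
    clipSteps-middle E pre post j (All.map (threeNeighbours⇒degree≢2 {pre ++ k ∷ post}) guard) degree≡2
      (All.map <⇒≢ pre<k) (All.map >⇒≢ k<post)
    where
    open Frame frame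
    a<k = proj₁ (proj₂ (triangle-bounds tri))
    k<b = proj₁ (proj₂ (proj₂ (triangle-bounds tri)))
    b≤ = proj₂ (proj₂ (proj₂ (triangle-bounds tri)))
    pre<k = All.map (λ x≤a → ≤-<-trans x≤a a<k) pre-≤
    k<post = All.map (λ b≤y → <-≤-trans k<b b≤y) post-≥
    alive-unique : Unique (pre ++ k ∷ post)
    alive-unique = AllPairs.map <⇒≢ (sorted-middle pre-sorted post-sorted pre<k k<post)
    onlyEnds : ∀ {u} → u ∈ pre ++ k ∷ post → T (adjacent E u k) → u ∈ lab a ∷ lab b ∷ []
    onlyEnds u∈ adj with apex-neighbour tri adj
    ... | inj₁ u≡ = here u≡
    ... | inj₂ (inj₁ u≡) = there (here u≡)
    ... | inj₂ (inj₂ (a<u , u<b)) with ∈-++⁻ pre u∈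
    ...   | inj₁ u∈pre = contradiction (All.lookup pre-≤ u∈pre) (<⇒≱ a<u)
    ...   | inj₂ (here refl) = contradiction adj (¬adjacent-self {k})
    ...   | inj₂ (there u∈post) = contradiction (All.lookup post-≥ u∈post) (<⇒≱ u<b)
    ends⊆alive : lab a ∷ lab b ∷ [] ⊆ pre ++ k ∷ post
    ends⊆alive (here refl) = ⊆-insert pre (k ∷ []) post lab-a∈
    ends⊆alive (there (here refl)) = ⊆-insert pre (k ∷ []) post lab-b∈
    degree≡2 : degree E (pre ++ k ∷ post) k ≡ 2
    degree≡2 = ≤-antisym (degree-≤ E alive-unique onlyEnds)
      (degree-≥ E {lab a ∷ lab b ∷ []} ((lab-≢ (<-trans a<k k<b) b≤ ∷ []) ∷ [] ∷ []) ends⊆alive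
        (proj₁ (apex-adjacent tri) ∷ proj₂ (apex-adjacent tri) ∷ []))

  frame-left : ∀ {a k b pre post} (R : Tree k b) → a < k → Frame a b pre post →
               Frame a k pre (k ∷ inorder R ++ post)
  frame-left {a} {k} {b} {pre} {post} R a<k frame = record
    { pre-sorted = pre-sorted
    ; post-sorted = k<rest ∷ AllPairs.++⁺ (inorder-sorted R) post-sorted
                                (All.map (λ (_ , x<b) → All.map (<-≤-trans x<b) post-≥) (inorder-between R))
    ; pre-≤ = pre-≤
    ; post-≥ = ≤-refl ∷ All.map <⇒≤ k<rest
    ; lab-a∈ = ⊆-insert pre (k ∷ inorder R) post lab-a∈
    ; lab-b∈ = ∈-++⁺ʳ pre (here (lab-positive (≤-<-trans z≤n a<k)))
    }
    where
    open Frame frame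
    k<rest : All (k <_) (inorder R ++ post)
    k<rest = All.++⁺ (All.map proj₁ (inorder-between R)) (All.map (<-≤-trans (tree-< R)) post-≥)

  frame-right : ∀ {a k b pre post} → a < k → Frame a b pre post → Frame k b (pre ++ k ∷ []) post
  frame-right {a} {k} {b} {pre} {post} a<k frame = record
    { pre-sorted = AllPairs.++⁺ pre-sorted ([] ∷ []) (All.map (_∷ []) pre<k)
    ; post-sorted = post-sorted
    ; pre-≤ = All.++⁺ (All.map <⇒≤ pre<k) (≤-refl ∷ [])
    ; post-≥ = post-≥
    ; lab-a∈ = ∈-++⁺ˡ (∈-++⁺ʳ pre (here (lab-positive (≤-<-trans z≤n a<k))))
    ; lab-b∈ = subst (lab b ∈_) (sym (++-assoc pre (k ∷ []) post)) (⊆-insert pre (k ∷ []) post lab-b∈)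
    }
    where
    open Frame frame
    pre<k = All.map (λ x≤a → ≤-<-trans x≤a a<k) pre-≤

  guard-left : ∀ {a k b pre post} (L : Tree a k) (R : Tree k b) → Guarded pre (node L R) post →
               Guarded pre L (k ∷ inorder R ++ post)
  guard-left leaf R guard = tt
  guard-left {k = k} {pre = pre} {post} (node {k = r} _ _) R guard =
    All.map (threeNeighbours-⊆ (⊆-insert pre (r ∷ []) _ ∘′ ++⁺ʳ pre (∷⁺ʳ k (xs⊆ys++xs post (inorder R))))) guard

  guard-right : ∀ {a k b pre post} (L : Tree a k) (R : Tree k b) → Triangle t a k b →
                (∀ {p r q} → Triangle R p r q → Triangle t p r q) →
                Frame a b pre post → Guarded pre (node L R) post → Guarded (pre ++ k ∷ []) R post
  guard-right L leaf _ _ _ _ = tt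
  guard-right {a} {k} {b} {pre} {post} L (node {k = r} _ _) tri embed frame guard =
    All.++⁺ (All.map (threeNeighbours-⊆ (⊆-reassoc ∘′ ++⁺ʳ pre (∷⁺ʳ k (xs⊆x∷xs post r)))) guard)
            (threeNeighbours-k ∷ [])
    where
    open Frame frame
    ⊆-reassoc : pre ++ k ∷ r ∷ post ⊆ (pre ++ k ∷ []) ++ r ∷ post
    ⊆-reassoc = subst ((pre ++ k ∷ r ∷ post) ⊆_) (sym (++-assoc pre (k ∷ []) (r ∷ post))) ⊆-refl
    a<k = proj₁ (proj₂ (triangle-bounds tri))
    triᴿ = embed root
    k<r = proj₁ (proj₂ (triangle-bounds triᴿ))
    r<b = proj₁ (proj₂ (proj₂ (triangle-bounds triᴿ)))
    b≤ = proj₂ (proj₂ (proj₂ (triangle-bounds triᴿ)))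
    r≤ = <⇒≤ (<-≤-trans r<b b≤)
    ends⊆ : pre ++ post ⊆ (pre ++ k ∷ []) ++ r ∷ post
    ends⊆ = ⊆-reassoc ∘′ ⊆-insert pre (k ∷ r ∷ []) post
    W⊆ : lab a ∷ lab b ∷ lab r ∷ [] ⊆ (pre ++ k ∷ []) ++ r ∷ post
    W⊆ (here refl) = ends⊆ lab-a∈
    W⊆ (there (here refl)) = ends⊆ lab-b∈
    W⊆ (there (there (here refl))) = ∈-++⁺ʳ (pre ++ k ∷ []) (here (lab-positive (apex-positive triᴿ)))
    r-adjacent : T (adjacent E (lab r) k)
    r-adjacent = subst (λ v → T (adjacent E (lab r) v)) (lab-positive (apex-positive tri))
                   (adjacent-lab (inj₂ (proj₁ (triangle-edges triᴿ))))
    threeNeighbours-k : ThreeNeighbours ((pre ++ k ∷ []) ++ r ∷ post) k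
    threeNeighbours-k = lab a ∷ lab b ∷ lab r ∷ [] , ≤-refl ,
      ((lab-≢ (<-trans a<k (<-trans k<r r<b)) b≤ ∷ lab-≢ (<-trans a<k k<r) r≤ ∷ []) ∷
       (≢-sym (lab-≢ r<b b≤) ∷ []) ∷ [] ∷ []) ,
      W⊆ , proj₁ (apex-adjacent tri) ∷ proj₂ (apex-adjacent tri) ∷ r-adjacent ∷ []

  map-prepend-node : ∀ (xs ys : List ℕ) k (X : Maybe (List ℕ)) →
                     Maybe.map (xs ++_) (Maybe.map (ys ++_) (Maybe.map (k ∷_) X)) ≡
                     Maybe.map ((xs ++ ys ++ k ∷ []) ++_) X
  map-prepend-node xs ys k nothing = refl
  map-prepend-node xs ys k (just s) =
    cong just (trans (cong (xs ++_) (sym (++-assoc ys (k ∷ []) s))) (sym (++-assoc xs (ys ++ k ∷ []) s)))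

  clip : ∀ {a b} (S : Tree a b) {pre post} → (∀ {p k q} → Triangle S p k q → Triangle t p k q) →
         Frame a b pre post → Guarded pre S post → ∀ j →
         clipSteps (size S + j) E (pre ++ inorder S ++ post) ≡
         Maybe.map (postorder S ++_) (clipSteps j E (pre ++ post))
  clip leaf {pre} {post} _ _ _ j = sym (Maybe.map-id (clipSteps j E (pre ++ post)))
  clip (node {a} {k} {b} L R) {pre} {post} embed frame guard j = begin
      clipSteps (size L + suc (size R) + j) E (pre ++ (inorder L ++ k ∷ inorder R) ++ post)
    ≡⟨ cong₂ (λ n xs → clipSteps n E (pre ++ xs)) size-shift (++-assoc (inorder L) (k ∷ inorder R) post) ⟩
      clipSteps (size L + (size R + suc j)) E (pre ++ inorder L ++ k ∷ inorder R ++ post)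
    ≡⟨ clip L (embed ∘′ inLeft) (frame-left R a<k frame) (guard-left L R guard) (size R + suc j) ⟩
      prependᴸ (clipSteps (size R + suc j) E (pre ++ k ∷ inorder R ++ post))
    ≡⟨ cong prependᴸ (reassoc (size R + suc j) (inorder R ++ post)) ⟩
      prependᴸ (clipSteps (size R + suc j) E ((pre ++ k ∷ []) ++ inorder R ++ post))
    ≡⟨ cong prependᴸ (clip R (embed ∘′ inRight) (frame-right a<k frame) guardᴿ (suc j)) ⟩
      prependᴸ (prependᴿ (clipSteps (suc j) E ((pre ++ k ∷ []) ++ post)))
    ≡⟨ cong (prependᴸ ∘′ prependᴿ) (reassoc (suc j) post) ⟨
      prependᴸ (prependᴿ (clipSteps (suc j) E (pre ++ k ∷ post)))
    ≡⟨ cong (prependᴸ ∘′ prependᴿ) (clip-apex (embed root) frame guard j) ⟩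
      prependᴸ (prependᴿ (Maybe.map (k ∷_) (clipSteps j E (pre ++ post))))
    ≡⟨ map-prepend-node (postorder L) (postorder R) k (clipSteps j E (pre ++ post)) ⟩
      Maybe.map (postorder (node L R) ++_) (clipSteps j E (pre ++ post))
    ∎
    where
    open ≡-Reasoning
    a<k = tree-< L
    prependᴸ = Maybe.map (postorder L ++_)
    prependᴿ = Maybe.map (postorder R ++_)
    guardᴿ = guard-right L R (embed root) (embed ∘′ inRight) frame guard
    reassoc : ∀ n ys → clipSteps n E (pre ++ k ∷ ys) ≡ clipSteps n E ((pre ++ k ∷ []) ++ ys)
    reassoc n ys = cong (clipSteps n E) (sym (++-assoc pre (k ∷ []) ys))
    size-shift : size L + suc (size R) + j ≡ size L + (size R + suc j)
    size-shift = trans (+-assoc (size L) (suc (size R)) j) (cong (size L +_) (sym (+-suc (size R) j)))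

  clipSeq≡postorder : clipSeq N D ≡ just (postorder t)
  clipSeq≡postorder = begin
      clipSteps m E (labels N)
    ≡⟨ cong₂ (λ n xs → clipSteps n E xs) m≡size+0 vertices≡ ⟩
      clipSteps (size t + 0) E ([] ++ inorder t ++ outer)
    ≡⟨ clip t (λ tri → tri) frame₀ (guard₀ t) 0 ⟩
      just (postorder t ++ [])
    ≡⟨ cong just (++-identityʳ (postorder t)) ⟩
      just (postorder t)
    ∎
    where
    open ≡-Reasoning
    outer = suc m ∷ N ∷ []
    m≡size : m ≡ size t
    m≡size = suc-injective (tree-size t)
    m≡size+0 : m ≡ size t + 0
    m≡size+0 = trans m≡size (sym (+-identityʳ (size t)))
    vertices≡ : labels N ≡ inorder t ++ outer
    vertices≡ = begin
      range 1 (2 + m)        ≡⟨ cong (range 1) (+-comm 2 m) ⟩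
      range 1 (m + 2)        ≡⟨ range-++ 1 m 2 ⟩
      range 1 m ++ outer     ≡⟨ cong (λ l → range 1 l ++ outer) m≡size ⟩
      range 1 (size t) ++ outer ≡⟨ cong (_++ outer) (inorder≡range t) ⟨
      inorder t ++ outer     ∎
    frame₀ : Frame 0 (suc m) [] outer
    frame₀ = record
      { pre-sorted = [] ; post-sorted = (≤-refl ∷ []) ∷ [] ∷ [] ; pre-≤ = [] ; post-≥ = ≤-refl ∷ n≤1+n _ ∷ []
      ; lab-a∈ = there (here refl) ; lab-b∈ = here refl }
    guard₀ : ∀ {a b} (S : Tree a b) → Guarded [] S outer
    guard₀ leaf = tt
    guard₀ (node _ _) = []

-- Postorders are the 312-avoiding permutations

No12Below : ℕ → List ℕ → Set
No12Below x = AllPairs (λ y z → ¬ (y < z × z < x))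

Avoids312ᴿ : List ℕ → Set
Avoids312ᴿ [] = ⊤
Avoids312ᴿ (x ∷ xs) = No12Below x xs × Avoids312ᴿ xs

avoids312ᴿ⇒avoids312 : ∀ σ → Avoids312ᴿ σ → Avoids312 σ
avoids312ᴿ⇒avoids312 (x ∷ xs) (no12 , _) fzero (fsuc j) (fsuc k) _ (s≤s j<k) = allPairs-lookup⁻ no12 j<k
avoids312ᴿ⇒avoids312 (x ∷ xs) (_ , avoids) (fsuc i) (fsuc j) (fsuc k) (s≤s i<j) (s≤s j<k) =
  avoids312ᴿ⇒avoids312 xs avoids i j k i<j j<k

avoids312⇒avoids312ᴿ : ∀ σ → Avoids312 σ → Avoids312ᴿ σ
avoids312⇒avoids312ᴿ [] _ = tt
avoids312⇒avoids312ᴿ (x ∷ xs) avoids =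
  allPairs-lookup⁺ (λ {j} {k} j<k → avoids fzero (fsuc j) (fsuc k) (s≤s z≤n) (s≤s j<k)) ,
  avoids312⇒avoids312ᴿ xs (λ i j k i<j j<k → avoids (fsuc i) (fsuc j) (fsuc k) (s≤s i<j) (s≤s j<k))

avoids312ᴿ-++ : ∀ xs {ys} → All (λ x → All (x <_) ys) xs → Avoids312ᴿ xs → Avoids312ᴿ ys →
                Avoids312ᴿ (xs ++ ys)
avoids312ᴿ-++ [] _ _ avoidsʸ = avoidsʸ
avoids312ᴿ-++ (x ∷ xs) {ys} (x<ys ∷ xs<ys) (no12 , avoidsˣ) avoidsʸ =
  AllPairs.++⁺ no12 (allPairs-right (λ x<z (_ , z<x) → <-asym x<z z<x) x<ys)
    (All.map (λ _ → All.map (λ x<z (_ , z<x) → <-asym x<z z<x) x<ys) xs<ys) ,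
  avoids312ᴿ-++ xs xs<ys avoidsˣ avoidsʸ

avoids312ᴿ-∷ʳ : ∀ ys {k} → All (k <_) ys → Avoids312ᴿ ys → Avoids312ᴿ (ys ++ k ∷ [])
avoids312ᴿ-∷ʳ [] _ _ = [] , tt
avoids312ᴿ-∷ʳ (y ∷ ys) (k<y ∷ k<ys) (no12 , avoids) =
  AllPairs.++⁺ no12 ([] ∷ []) (All.map (λ k<z → (λ (z<k , _) → <-asym z<k k<z) ∷ []) k<ys) ,
  avoids312ᴿ-∷ʳ ys k<ys avoids

postorder-between : ∀ {a b} (t : Tree a b) → All (Between a b) (postorder t)
postorder-between leaf = []
postorder-between (node L R) =
  All.++⁺ (All.map (λ (a<x , x<k) → a<x , <-trans x<k (tree-< R)) (postorder-between L))
    (All.++⁺ (All.map (λ (k<x , x<b) → <-trans (tree-< L) k<x , x<b) (postorder-between R))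
             ((tree-< L , tree-< R) ∷ []))

postorder-avoids312ᴿ : ∀ {a b} (t : Tree a b) → Avoids312ᴿ (postorder t)
postorder-avoids312ᴿ leaf = tt
postorder-avoids312ᴿ (node L R) =
  avoids312ᴿ-++ (postorder L)
    (All.map (λ (_ , x<k) → All.++⁺ (All.map (λ (k<y , _) → <-trans x<k k<y) (postorder-between R)) (x<k ∷ []))
      (postorder-between L))
    (postorder-avoids312ᴿ L)
    (avoids312ᴿ-∷ʳ (postorder R) (All.map proj₁ (postorder-between R)) (postorder-avoids312ᴿ R))

postorder↭inorder : ∀ {a b} (t : Tree a b) → postorder t ↭ inorder t
postorder↭inorder leaf = ↭-refl
postorder↭inorder (node {k = k} L R) =
  ++⁺ (postorder↭inorder L) (↭-trans (↭-sym (∷↭∷ʳ k (postorder R))) (prep k (postorder↭inorder R)))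

postorder-separated : ∀ {a k b} (L : Tree a k) (R : Tree k b) →
                      filter (_<? k) (postorder L ++ postorder R) ≡ postorder L ×
                      filter (k <?_) (postorder L ++ postorder R) ≡ postorder R
postorder-separated L R =
  filter-separated (postorder L) (All.map proj₂ (postorder-between L)) (All.map proj₁ (postorder-between R))

postorder-node : ∀ {a k b} (L : Tree a k) (R : Tree k b) → postorder (node L R) ≡ (postorder L ++ postorder R) ∷ʳ k
postorder-node {k = k} L R = sym (++-assoc (postorder L) (postorder R) (k ∷ []))

postorder-injective : ∀ {a b} (t t′ : Tree a b) → postorder t ≡ postorder t′ → t ≡ t′
postorder-injective leaf leaf _ = refl
postorder-injective leaf (node L R) eq = contradiction (trans (sym (postorder-node L R)) (sym eq)) (∷ʳ≢[] _)
postorder-injective (node L R) leaf eq = contradiction (trans (sym (postorder-node L R)) eq) (∷ʳ≢[] _)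
postorder-injective (node {k = k} L R) (node L′ R′) eq
  with ∷ʳ-injective (postorder L ++ postorder R) (postorder L′ ++ postorder R′)
         (trans (sym (postorder-node L R)) (trans eq (postorder-node L′ R′)))
... | children≡ , refl = cong₂ node (postorder-injective L L′ left≡) (postorder-injective R R′ right≡)
  where
  open ≡-Reasoning
  left≡ : postorder L ≡ postorder L′
  left≡ = begin
    postorder L                                   ≡⟨ proj₁ (postorder-separated L R) ⟨
    filter (_<? k) (postorder L ++ postorder R)   ≡⟨ cong (filter (_<? k)) children≡ ⟩
    filter (_<? k) (postorder L′ ++ postorder R′) ≡⟨ proj₁ (postorder-separated L′ R′) ⟩
    postorder L′                                  ∎
  right≡ : postorder R ≡ postorder R′
  right≡ = begin
    postorder R                                   ≡⟨ proj₂ (postorder-separated L R) ⟨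
    filter (k <?_) (postorder L ++ postorder R)   ≡⟨ cong (filter (k <?_)) children≡ ⟩
    filter (k <?_) (postorder L′ ++ postorder R′) ≡⟨ proj₂ (postorder-separated L′ R′) ⟩
    postorder R′                                  ∎

avoids312ᴿ-++⁻ˡ : ∀ xs {ys} → Avoids312ᴿ (xs ++ ys) → Avoids312ᴿ xs
avoids312ᴿ-++⁻ˡ [] _ = tt
avoids312ᴿ-++⁻ˡ (x ∷ xs) (no12 , avoids) = allPairs-++⁻ˡ xs no12 , avoids312ᴿ-++⁻ˡ xs avoids

avoids312ᴿ-filter : ∀ {P : ℕ → Set} (P? : Decidable P) σ → Avoids312ᴿ σ → Avoids312ᴿ (filter P? σ)
avoids312ᴿ-filter P? [] _ = tt
avoids312ᴿ-filter P? (x ∷ xs) (no12 , avoids) with P? x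
... | yes _ = AllPairs.filter⁺ P? no12 , avoids312ᴿ-filter P? xs avoids
... | no _ = avoids312ᴿ-filter P? xs avoids

-- An entry above k followed by an entry below k would form a 312 with k.
avoids312ᴿ-split : ∀ σ {k} → Avoids312ᴿ (σ ++ k ∷ []) → k ∉ σ → σ ≡ filter (_<? k) σ ++ filter (k <?_) σ
avoids312ᴿ-split [] _ _ = refl
avoids312ᴿ-split (x ∷ xs) {k} (no12 , avoids) k∉ with <-cmp x k
... | tri< x<k _ _ = sym (trans (cong₂ _++_ (filter-accept (_<? k) x<k) (filter-reject (k <?_) (<-asym x<k)))
                                (cong (x ∷_) (sym (avoids312ᴿ-split xs avoids (k∉ ∘′ there)))))
... | tri≈ _ refl _ = contradiction (here refl) k∉
... | tri> _ _ k<x =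
  sym (cong₂ _++_ (filter-none (_<? k) (<-asym k<x ∷ All.map <-asym xs>k)) (filter-all (k <?_) (k<x ∷ xs>k)))
  where
  xs>k : All (k <_) xs
  xs>k = All.tabulate λ {y} y∈ → case <-cmp k y of λ
    { (tri< k<y _ _) → k<y
    ; (tri≈ _ refl _) → contradiction (there y∈) k∉
    ; (tri> _ _ y<k) → contradiction (y<k , k<x) (All.lookup (allPairs-∷ʳ⁻ xs no12) y∈) }

PostorderOf : ℕ → ℕ → List ℕ → Set
PostorderOf a l σ = ∃[ b ] Σ (Tree a b) λ t → b ≡ suc (a + l) × postorder t ≡ σ

PostorderSurjective : ℕ → Set
PostorderSurjective l = ∀ a σ → σ ↭ range (suc a) l → Avoids312ᴿ σ → PostorderOf a l σ

-- The last entry k of σ is the apex; the entries below and above k give the two subtrees.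
postorder-∷ʳ : ∀ {l} a σ′ k → (∀ {l′} → l′ < suc l → PostorderSurjective l′) →
               σ′ ∷ʳ k ↭ range (suc a) (suc l) → Avoids312ᴿ (σ′ ∷ʳ k) → PostorderOf a (suc l) (σ′ ∷ʳ k)
postorder-∷ʳ {l} a σ′ k rec σ↭ avoids with ∈-range-split (suc a) (suc l) (∈-resp-↭ σ↭ (∈-++⁺ʳ σ′ (here refl)))
... | i , j , l≡ , refl , range≡ =
  combine (rec i<l a α α↭ (avoids312ᴿ-filter (_<? k) σ′ avoidsσ′))
          (rec j<l k β β↭ (avoids312ᴿ-filter (k <?_) σ′ avoidsσ′))
  where
  i<l : i < suc l
  i<l = subst (i <_) (sym l≡) (m<m+n i (s≤s z≤n))
  j<l : j < suc l
  j<l = subst (j <_) (sym l≡) (<-≤-trans ≤-refl (m≤n+m (suc j) i))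
  RL = range (suc a) i
  RR = range (suc k) j
  σ′↭ : σ′ ↭ RL ++ RR
  σ′↭ = subst (_↭ RL ++ RR) (++-identityʳ σ′) (drop-mid σ′ RL (subst (σ′ ∷ʳ k ↭_) range≡ σ↭))
  RL<k : All (_< k) RL
  RL<k = All.tabulate (λ x∈ → proj₂ (∈-range⁻ (suc a) i x∈))
  k<RR : All (k <_) RR
  k<RR = All.tabulate (λ x∈ → proj₁ (∈-range⁻ (suc k) j x∈))
  k∉σ′ : k ∉ σ′
  k∉σ′ k∈ with ∈-++⁻ RL (∈-resp-↭ σ′↭ k∈)
  ... | inj₁ k∈RL = <-irrefl refl (All.lookup RL<k k∈RL)
  ... | inj₂ k∈RR = <-irrefl refl (All.lookup k<RR k∈RR)
  α = filter (_<? k) σ′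
  β = filter (k <?_) σ′
  α↭ : α ↭ RL
  α↭ = subst (α ↭_) (proj₁ (filter-separated RL RL<k k<RR)) (filter-↭ (_<? k) σ′↭)
  β↭ : β ↭ RR
  β↭ = subst (β ↭_) (proj₂ (filter-separated RL RL<k k<RR)) (filter-↭ (k <?_) σ′↭)
  avoidsσ′ : Avoids312ᴿ σ′
  avoidsσ′ = avoids312ᴿ-++⁻ˡ σ′ avoids
  right-end : suc (k + j) ≡ suc (a + suc l)
  right-end = cong suc (trans (sym (+-suc (a + i) j)) (trans (+-assoc a i (suc j)) (cong (a +_) (sym l≡))))
  combine : PostorderOf a i α → PostorderOf k j β → PostorderOf a (suc l) (σ′ ∷ʳ k)
  combine (_ , L , refl , postorderL≡) (b , R , b≡ , postorderR≡) =
    b , node L R , trans b≡ right-end ,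
    trans (postorder-node L R) (cong (_∷ʳ k) (trans (cong₂ _++_ postorderL≡ postorderR≡)
                                                    (sym (avoids312ᴿ-split σ′ avoids k∉σ′))))

postorder-surjective : ∀ l → PostorderSurjective l
postorder-surjective = <-rec PostorderSurjective step
  where
  step : ∀ l → (∀ {l′} → l′ < l → PostorderSurjective l′) → PostorderSurjective l
  step zero _ a σ σ↭ _ = suc a , leaf , cong suc (sym (+-identityʳ a)) , sym (↭-empty-inv σ↭)
  step (suc l) rec a σ σ↭ avoids with initLast σ
  ... | [] = contradiction (↭-empty-inv (↭-sym σ↭)) λ ()
  ... | σ′ ∷ʳ′ k = postorder-∷ʳ a σ′ k rec σ↭ avoids

module _ (m : ℕ) where
  open Polygon m

  triangulation-clipSeq : ∀ D → IsTriangulation N D →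
    ∃[ t ] ((∀ e → e ∈ D ⇔ e ∈ triangulationOf t) × clipSeq N D ≡ just (postorder t))
  triangulation-clipSeq D isTri =
    let (t , D≈t) = triangulationOf-complete D isTri in t , D≈t , Clipping.clipSeq≡postorder m t D D≈t

  postorder↭labels : (t : Tree 0 (suc m)) → postorder t ↭ labels m
  postorder↭labels t = ↭-trans (postorder↭inorder t)
    (↭-reflexive (trans (inorder≡range t) (cong (range 1) (sym (suc-injective (tree-size t))))))

theorem1 : ∀ (n : ℕ) → 3 ≤ n →
    (∀ (D : List Edge) → IsTriangulation n D →
        ∃[ σ ] (clipSeq n D ≡ just σ × σ ↭ labels (n ∸ 2) × Avoids312 σ))
    × (∀ (D₁ D₂ : List Edge) → IsTriangulation n D₁ → IsTriangulation n D₂ →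
        clipSeq n D₁ ≡ clipSeq n D₂ → ∀ (e : Edge) → (e ∈ D₁ ⇔ e ∈ D₂))
    × (∀ (σ : List ℕ) → σ ↭ labels (n ∸ 2) → Avoids312 σ →
        ∃[ D ] (IsTriangulation n D × clipSeq n D ≡ just σ))
theorem1 (suc zero) (s≤s ())
theorem1 (suc (suc m)) _ = clipSeq-avoids312 , clipSeq-injective , clipSeq-surjective
  where
  open Polygon m
  clipSeq-avoids312 : ∀ D → IsTriangulation N D → ∃[ σ ] (clipSeq N D ≡ just σ × σ ↭ labels m × Avoids312 σ)
  clipSeq-avoids312 D isTri =
    let (t , _ , clipSeq≡) = triangulation-clipSeq m D isTri in
    postorder t , clipSeq≡ , postorder↭labels m t , avoids312ᴿ⇒avoids312 (postorder t) (postorder-avoids312ᴿ t)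
  clipSeq-injective : ∀ D₁ D₂ → IsTriangulation N D₁ → IsTriangulation N D₂ →
                      clipSeq N D₁ ≡ clipSeq N D₂ → ∀ e → e ∈ D₁ ⇔ e ∈ D₂
  clipSeq-injective D₁ D₂ isTri₁ isTri₂ clipSeq≡ e
    with triangulation-clipSeq m D₁ isTri₁ | triangulation-clipSeq m D₂ isTri₂
  ... | t₁ , D₁≈t₁ , clipSeq₁ | t₂ , D₂≈t₂ , clipSeq₂
    with postorder-injective t₁ t₂ (Maybe.just-injective (trans (sym clipSeq₁) (trans clipSeq≡ clipSeq₂)))
  ... | refl = ⇔-sym (D₂≈t₂ e) ⇔-∘ D₁≈t₁ e
  clipSeq-surjective : ∀ σ → σ ↭ labels m → Avoids312 σ → ∃[ D ] (IsTriangulation N D × clipSeq N D ≡ just σ)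
  clipSeq-surjective σ σ↭ avoids with postorder-surjective m 0 σ σ↭ (avoids312⇒avoids312ᴿ σ avoids)
  ... | _ , t , refl , postorder≡σ =
    triangulationOf t , triangulationOf-isTriangulation t ,
    trans (Clipping.clipSeq≡postorder m t (triangulationOf t) (λ _ → ⇔-id _)) (cong just postorder≡σ)
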